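{- Let $n = 2^i$ with $i \ge 2$ and nails $V = \{1,\dots,n\}$. Define words recursively for a set $U$ of $2^t$ consecutive nails, with $L$ the lower half and $R$ the upper half of $U$: $B_1(\{a\}) = a$ and $B_1(U) = [B_1(L), B_1(R)]$; $B_2(\{a,b\}) = a + b$ (for $a<b$), and for $|U| \ge 4$ let $D_L = B_2(L)$, $D_R = B_2(R)$, $D_\times = B_1(L) + B_1(R)$, and set $B_2(U) = [X, [Y, Z]]$ where $X$ is one of $D_L, D_R, D_\times$ of maximal letter count (counted as unreduced concatenated words) and $Y, Z$ are the other two (in either order; ties broken arbitrarily). Then $B_2(V)$ is a solution to the $2$-out-of-$n$ picture-hanging puzzle, and its length is at most $\frac{8}{3}\, n^{\log_2 6} - 4 n^2$.
   Context: Expressions are words in the free group on the nails $1,\dots,n$, written additively: $+$ is concatenation/group operation (non-commutative), $-x$ the inverse (reverse the word and invert each letter), $0$ the identity. The commutator is $[a,b] = a + b - a - b$. The length of an expression is the number of signed letters of its freely reduced word. For a set $S$ of nails, $w|_S$ denotes $w$ with every variable in $S$ set to $0$. A solution to the $k$-out-of-$n$ puzzle (Demaine's convention) is an expression $w$ with $w \ne 0$, $w|_S = 0$ for every set $S$ of $k$ nails, and $w|_S \ne 0$ for every set $S$ of fewer than $k$ nails. -}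

module Defs where

open import Data.Nat using (ℕ; zero; suc; _+_; _*_; _^_; _≤_; _<_; _<?_; _≡ᵇ_)
open import Data.Bool using (Bool; true; false; not; _∧_; _xor_; if_then_else_)
open import Data.Product using (_×_; _,_; proj₁)
open import Data.List using (List; []; _∷_; _++_; map; reverse; foldr; filterᵇ; length)
open import Data.Fin using (Fin; fromℕ<)
open import Data.Fin.Subset using (Subset; ∣_∣)
open import Data.Vec using (lookup)
open import Relation.Nullary using (¬_; yes; no)
open import Relation.Nullary.Decidable using (does)
open import Relation.Unary using (Decidable)
open import Relation.Binary.PropositionalEquality using (_≡_)

-- A signed letter: (nail, sign); sign true = the nail a, false = its inverse -a.
Letter : Set
Letter = ℕ × Bool

Word : Set
Word = List Letter

inv : Word → Word
inv w = reverse (map (λ { (a , s) → (a , not s) }) w)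

comm : Word → Word → Word
comm a b = a ++ b ++ inv a ++ inv b

cancels : Letter → Letter → Bool
cancels (a , s) (b , t) = (a ≡ᵇ b) ∧ (s xor t)

push : Letter → Word → Word
push x [] = x ∷ []
push x (y ∷ ys) = if cancels x y then ys else x ∷ y ∷ ys

reduce : Word → Word
reduce = foldr push []

IsZero : Word → Set
IsZero w = reduce w ≡ []

len : Word → ℕ
len w = length (reduce w)

-- membership of nail a (nails are 1..n) in a set S ⊆ {1..n}, where
-- nail a corresponds to index a-1 of Fin n
inS : ∀ {n} → Subset n → ℕ → Bool
inS S zero = false
inS {n} S (suc m) with m <? n
... | yes p = lookup S (fromℕ< p)
... | no _ = false

-- w|_S : set every nail in S to 0
restrict : ∀ {n} → Subset n → Word → Word
restrict S w = filterᵇ (λ x → not (inS S (proj₁ x))) w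

record Solution (k n : ℕ) (w : Word) : Set where
  field
    nonzero   : ¬ IsZero w
    falls     : ∀ (S : Subset n) → ∣ S ∣ ≡ k → IsZero (restrict S w)
    holds     : ∀ (S : Subset n) → ∣ S ∣ < k → ¬ IsZero (restrict S w)

-- B₁ on the interval U = {s+1, …, s+2^t}
B1 : ℕ → ℕ → Word
B1 s zero = (suc s , true) ∷ []
B1 s (suc t) = comm (B1 s t) (B1 (s + 2 ^ t) t)

data Arrange (a b c : Word) : Word → Word → Word → Set where
  abc : Arrange a b c a b c
  acb : Arrange a b c a c b
  bac : Arrange a b c b a c
  bca : Arrange a b c b c a
  cab : Arrange a b c c a b
  cba : Arrange a b c c b a

Choice : Word → Word → Word → Word → Word → Word → Set
Choice a b c X Y Z = Arrange a b c X Y Z × length Y ≤ length X × length Z ≤ length X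

-- IsB2 s t w : w is a (valid choice of) B₂(U) for U = {s+1, …, s+2^t}, t ≥ 1.
data IsB2 : ℕ → ℕ → Word → Set where
  base : ∀ s → IsB2 s 1 ((suc s , true) ∷ (suc (suc s) , true) ∷ [])
  step : ∀ s t {dl dr X Y Z : Word} →
         IsB2 s (suc t) dl →
         IsB2 (s + 2 ^ suc t) (suc t) dr →
         Choice dl dr (B1 s (suc t) ++ B1 (s + 2 ^ suc t) (suc t)) X Y Z →
         IsB2 s (suc (suc t)) (comm X (comm Y Z))

module Submission where

-- B₂ falls when two nails are removed: they either both lie in one half, killing B₂(L) or
-- B₂(R) by induction, or one lies in each half, killing B₁(L) + B₁(R); a nested commutator
-- with a trivial entry is trivial.
--
-- B₂ holds when at most one nail is removed because of one fact about free groups: if a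
-- commutes with b ≠ 1 and a deletion homomorphism kills b, it kills a (centralisers are
-- cyclic and free groups are torsion-free).  So [a, b] survives the removal of P as soon as
-- b survives it and removing some further nails K kills b but not a.  For every pair among
-- B₂(L), B₂(R), B₁(L) + B₁(R), and for each of them against the commutator of the other two,
-- such a K consisting of at most two nails exists, given that P meets the block at most once.
--
-- For the length bound, the unreduced length of B₂(V) is exactly (8·6ⁱ − 12·4ⁱ) / 3.

open import Defs
open import Algebra.Bundles using (Group)
open import Data.Bool using (Bool; true; false; not; _∨_; if_then_else_; T)
import Data.Bool as Bool
open import Data.Bool.Properties using (not-involutive; not-¬; ¬-not; ∨-zeroʳ; T-≡)
open import Data.Fin using (toℕ; fromℕ<; zero; suc)
import Data.Fin.Properties as Fin
open import Data.Fin.Properties using (toℕ<n; toℕ-injective; fromℕ<-toℕ; toℕ-fromℕ<)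
open import Data.Fin.Subset using (Subset; ∣_∣; _∈_; _-_)
open import Data.Fin.Subset.Properties using (x∈p⇒∣p-x∣<∣p∣; x∈p∧x≢y⇒x∈p-y)
open import Data.List
  using ([]; _∷_; _++_; _∷ʳ_; [_]; _∷ʳ′_; initLast; map; reverse; foldr; length; filterᵇ; head; last)
open import Data.List.Properties
  using (++-assoc; ++-identityʳ; ++-monoid; ++-conicalʳ; ++-cancelˡ; ∷-injective; foldr-++; filter-++;
         unfold-reverse; reverse-++; reverse-involutive; reverse-map; map-++; map-∘; map-id; map-cong;
         length-++; length-++-comm; length-++-≤ˡ; length-++-≤ʳ; length-reverse; length-map)
open import Data.List.Relation.Unary.Linked using (Linked; []; [-]; _∷_)
import Data.List.Relation.Unary.Linked as Linked
open import Data.List.Relation.Unary.Linked.Properties using (++⁺)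
open import Data.Maybe using (just; nothing)
open import Data.Maybe.Properties using (just-injective)
open import Data.Maybe.Relation.Binary.Connected using (Connected; just; just-nothing; nothing-just; nothing)
open import Data.Nat using (ℕ; zero; suc; _+_; _*_; _^_; _⊔_; _≤_; _<_; _≡ᵇ_; _≟_; _≤?_; _<?_; z≤n; s≤s; z<s)
open import Data.Nat.Properties
  using (≡ᵇ⇒≡; ≡⇒≡ᵇ; suc-injective; anyUpTo?;
         ≤-refl; ≤-reflexive; ≤-trans; ≤-antisym; ≤-total;
         <-irrefl; ≤-<-trans; <-≤-trans; <⇒≢; <⇒≱; ≰⇒>;
         n<1+n; n≤1+n; m≤n⇒m≤1+n; m<n⇒m<1+n; m<m+n; m<n+m; m≤m+n;
         +-comm; +-assoc; +-suc; +-identityʳ; +-monoˡ-≤; +-monoʳ-≤; +-cancelʳ-≤; +-cancelʳ-≡;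
         *-monoˡ-≤; *-monoʳ-≤; *-cancelˡ-≤; *-cancelˡ-≡; m^n>0; ^-monoʳ-≤;
         ⊔-idem; ⊔-lub; m≥n⇒m⊔n≡m; m≤n⇒m⊔n≡n; module ≤-Reasoning)
open import Data.Nat.Tactic.RingSolver using (solve-∀)
open import Data.Product using (_×_; _,_; proj₁; proj₂; ∃-syntax)
open import Data.Product.Properties using (≡-dec)
open import Data.Sum using (_⊎_; inj₁; inj₂; [_,_]′; map₂; swap)
open import Data.Vec using (_∷_; lookup; here; there)
open import Data.Vec.Properties using ([]=⇒lookup; lookup⇒[]=)
open import Function.Base using (_∘_; id)
open import Function.Bundles using (Equivalence)
open import Level using (0ℓ)
open import Relation.Binary.Bundles using (Setoid)
open import Relation.Binary.PropositionalEquality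
  using (_≡_; _≢_; refl; sym; trans; cong; cong₂; subst; module ≡-Reasoning)
import Relation.Binary.Reasoning.Setoid as SetoidReasoning
open import Relation.Binary.Structures using (IsEquivalence)
open import Relation.Nullary using (¬_; contradiction; yes; no)
open import Relation.Nullary.Decidable using (T?; _×-dec_)
open import Tactic.MonoidSolver using (solve)

-- Free reduction

flipSign : Letter → Letter
flipSign (a , s) = (a , not s)

flipSign-involutive : ∀ x → flipSign (flipSign x) ≡ x
flipSign-involutive (a , s) = cong (a ,_) (not-involutive s)

cancels⇒flipSign : ∀ x y → cancels x y ≡ true → y ≡ flipSign x
cancels⇒flipSign (a , s) (b , t) c with a ≡ᵇ b in a≡ᵇb
cancels⇒flipSign (a , true)  (b , false) refl | true with refl ← ≡ᵇ⇒≡ a b (subst T (sym a≡ᵇb) _) = refl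
cancels⇒flipSign (a , false) (b , true)  refl | true with refl ← ≡ᵇ⇒≡ a b (subst T (sym a≡ᵇb) _) = refl

cancels-flipSign : ∀ x → cancels x (flipSign x) ≡ true
cancels-flipSign (a , s) with a ≡ᵇ a | ≡⇒≡ᵇ a a refl
cancels-flipSign (a , true)  | true | _ = refl
cancels-flipSign (a , false) | true | _ = refl

cancels-flipSignˡ : ∀ x → cancels (flipSign x) x ≡ true
cancels-flipSignˡ x = subst (λ y → cancels (flipSign x) y ≡ true) (flipSign-involutive x) (cancels-flipSign (flipSign x))

NonCancelling : Letter → Letter → Set
NonCancelling x y = cancels x y ≡ false

noncancelling : ∀ {x y} → y ≢ flipSign x → NonCancelling x y
noncancelling {x} {y} y≢x⁻¹ with cancels x y in c
... | true  = contradiction (cancels⇒flipSign x y c) y≢x⁻¹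
... | false = refl

noncancelling-flipSign : ∀ {x y} → NonCancelling x y → NonCancelling (flipSign y) (flipSign x)
noncancelling-flipSign {x} {y} nc = noncancelling {flipSign y} λ x⁻¹≡y → contradiction (begin
  true                   ≡⟨ cancels-flipSign x ⟨
  cancels x (flipSign x) ≡⟨ cong (cancels x) (trans x⁻¹≡y (flipSign-involutive y)) ⟩
  cancels x y            ≡⟨ nc ⟩
  false                  ∎) λ ()
  where open ≡-Reasoning

Reduced : Word → Set
Reduced = Linked NonCancelling

push-Reduced : ∀ x {w} → Reduced w → Reduced (push x w)
push-Reduced x {[]}     _ = [-]
push-Reduced x {y ∷ ys} r with cancels x y in c
... | true  = Linked.tail r
... | false = c ∷ r

foldr-push-Reduced : ∀ u {r} → Reduced r → Reduced (foldr push r u)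
foldr-push-Reduced []      r = r
foldr-push-Reduced (x ∷ u) r = push-Reduced x (foldr-push-Reduced u r)

reduce-Reduced : ∀ w → Reduced (reduce w)
reduce-Reduced w = foldr-push-Reduced w []

reduce-Reduced-id : ∀ {w} → Reduced w → reduce w ≡ w
reduce-Reduced-id []  = refl
reduce-Reduced-id [-] = refl
reduce-Reduced-id {x ∷ y ∷ w} (nc ∷ r) rewrite reduce-Reduced-id r | nc = refl

push-Reduced-∷ : ∀ {x w} → Reduced (x ∷ w) → push x w ≡ x ∷ w
push-Reduced-∷ [-]      = refl
push-Reduced-∷ (nc ∷ _) rewrite nc = refl

push-push-cancel : ∀ {x y} z → Reduced z → cancels x y ≡ true → push x (push y z) ≡ z
push-push-cancel [] _ c rewrite c = refl
push-push-cancel {x} {y} (z ∷ zs) r c with cancels y z in c′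
... | false rewrite c = refl
... | true with refl ← cancels⇒flipSign x y c | refl ← cancels⇒flipSign y z c′
  rewrite flipSign-involutive x = push-Reduced-∷ r

foldr-push-push : ∀ x {v r} → Reduced v → Reduced r →
                  foldr push r (push x v) ≡ push x (foldr push r v)
foldr-push-push x {[]}     _ _ = refl
foldr-push-push x {y ∷ ys} v r with cancels x y in c
... | true  = sym (push-push-cancel (foldr push _ ys) (foldr-push-Reduced ys r) c)
... | false = refl

foldr-push-reduce : ∀ u {r} → Reduced r → foldr push r u ≡ foldr push r (reduce u)
foldr-push-reduce []      _ = refl
foldr-push-reduce (x ∷ u) r = trans (cong (push x) (foldr-push-reduce u r))
                                    (sym (foldr-push-push x (reduce-Reduced u) r))

reduce-++ : ∀ u v → reduce (u ++ v) ≡ foldr push (reduce v) (reduce u)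
reduce-++ u v = trans (foldr-++ push [] u v) (foldr-push-reduce u (reduce-Reduced v))

-- The free group

infix 4 _≈_
record _≈_ (u v : Word) : Set where
  constructor mk≈
  field reduce-≡ : reduce u ≡ reduce v

≈-isEquivalence : IsEquivalence _≈_
≈-isEquivalence = record
  { refl  = mk≈ refl
  ; sym   = λ (mk≈ p) → mk≈ (sym p)
  ; trans = λ (mk≈ p) (mk≈ q) → mk≈ (trans p q)
  }

≈-setoid : Setoid 0ℓ 0ℓ
≈-setoid = record { isEquivalence = ≈-isEquivalence }

open IsEquivalence ≈-isEquivalence public
  using () renaming (refl to ≈-refl; sym to ≈-sym; trans to ≈-trans; reflexive to ≡⇒≈)

module ≈-Reasoning = SetoidReasoning ≈-setoid

letter≉[] : ∀ x → ¬ [ x ] ≈ []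
letter≉[] x (mk≈ ())

reduce-≈ : ∀ w → reduce w ≈ w
reduce-≈ w = mk≈ (reduce-Reduced-id (reduce-Reduced w))

++-cong : ∀ {u u′ v v′} → u ≈ u′ → v ≈ v′ → u ++ v ≈ u′ ++ v′
++-cong {u} {u′} {v} {v′} (mk≈ p) (mk≈ q) = mk≈ (begin
  reduce (u ++ v)                   ≡⟨ reduce-++ u v ⟩
  foldr push (reduce v) (reduce u)  ≡⟨ cong₂ (λ r s → foldr push s r) p q ⟩
  foldr push (reduce v′) (reduce u′) ≡⟨ reduce-++ u′ v′ ⟨
  reduce (u′ ++ v′)                 ∎)
  where open ≡-Reasoning

inv-∷ : ∀ x w → inv (x ∷ w) ≡ inv w ++ [ flipSign x ]
inv-∷ x w = unfold-reverse (flipSign x) (map flipSign w)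

inv-++ : ∀ u v → inv (u ++ v) ≡ inv v ++ inv u
inv-++ u v = trans (cong reverse (map-++ flipSign u v)) (reverse-++ (map flipSign u) (map flipSign v))

inv-involutive : ∀ w → inv (inv w) ≡ w
inv-involutive w = begin
  reverse (map flipSign (reverse (map flipSign w))) ≡⟨ cong reverse (reverse-map flipSign (map flipSign w)) ⟩
  reverse (reverse (map flipSign (map flipSign w))) ≡⟨ reverse-involutive _ ⟩
  map flipSign (map flipSign w)                     ≡⟨ map-∘ w ⟨
  map (λ x → flipSign (flipSign x)) w               ≡⟨ map-cong flipSign-involutive w ⟩
  map id w                                          ≡⟨ map-id w ⟩
  w                                                 ∎
  where open ≡-Reasoning

length-inv : ∀ w → length (inv w) ≡ length w
length-inv w = trans (length-reverse (map flipSign w)) (length-map flipSign w)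

++-inverseʳ : ∀ w → w ++ inv w ≈ []
++-inverseʳ []      = ≈-refl
++-inverseʳ (x ∷ w) = begin
  x ∷ w ++ inv (x ∷ w)                    ≡⟨ cong (λ u → x ∷ w ++ u) (inv-∷ x w) ⟩
  x ∷ w ++ inv w ++ [ flipSign x ]        ≡⟨ cong (x ∷_) (++-assoc w (inv w) _) ⟨
  [ x ] ++ (w ++ inv w) ++ [ flipSign x ] ≈⟨ ++-cong (≈-refl {[ x ]}) (++-cong (++-inverseʳ w) ≈-refl) ⟩
  x ∷ flipSign x ∷ []                     ≈⟨ mk≈ (cong (λ b → if b then [] else x ∷ flipSign x ∷ []) (cancels-flipSign x)) ⟩
  []                                      ∎
  where open ≈-Reasoning

++-inverseˡ : ∀ w → inv w ++ w ≈ []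
++-inverseˡ w = subst (λ u → inv w ++ u ≈ []) (inv-involutive w) (++-inverseʳ (inv w))

inv-cong : ∀ {u v} → u ≈ v → inv u ≈ inv v
inv-cong {u} {v} u≈v = begin
  inv u                    ≡⟨ ++-identityʳ (inv u) ⟨
  inv u ++ []              ≈⟨ ++-cong ≈-refl (++-inverseʳ v) ⟨
  inv u ++ v ++ inv v      ≡⟨ ++-assoc (inv u) v (inv v) ⟨
  (inv u ++ v) ++ inv v    ≈⟨ ++-cong (++-cong (≈-refl {inv u}) u≈v) ≈-refl ⟨
  (inv u ++ u) ++ inv v    ≈⟨ ++-cong (++-inverseˡ u) ≈-refl ⟩
  inv v                    ∎
  where open ≈-Reasoning

freeGroup : Group 0ℓ 0ℓ
freeGroup = record
  { isGroup = record
    { isMonoid = record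
      { isSemigroup = record
        { isMagma = record { isEquivalence = ≈-isEquivalence ; ∙-cong = ++-cong }
        ; assoc = λ u v w → ≡⇒≈ (++-assoc u v w)
        }
      ; identity = (λ _ → ≈-refl) , λ w → ≡⇒≈ (++-identityʳ w)
      }
    ; inverse = ++-inverseˡ , ++-inverseʳ
    ; ⁻¹-cong = inv-cong
    }
  }

open import Algebra.Properties.Group freeGroup using (x∙y⁻¹≈ε⇒x≈y; ∙-cancelˡ)

-- Deleting nails

Nails : Set
Nails = ℕ → Bool

infixr 6 _∪_
_∪_ : Nails → Nails → Nails
(P ∪ Q) a = P a ∨ Q a

⁅_⁆ : ℕ → Nails
⁅ a ⁆ x = a ≡ᵇ x

⁅⁆-self : ∀ a → ⁅ a ⁆ a ≡ true
⁅⁆-self a = Equivalence.to T-≡ (≡⇒≡ᵇ a a refl)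

⁅⁆-true : ∀ {a x} → ⁅ a ⁆ x ≡ true → a ≡ x
⁅⁆-true {a} {x} e = ≡ᵇ⇒≡ a x (Equivalence.from T-≡ e)

∪-trueˡ : ∀ P Q {x} → P x ≡ true → (P ∪ Q) x ≡ true
∪-trueˡ P Q {x} e = cong (_∨ Q x) e

∪-trueʳ : ∀ P Q {x} → Q x ≡ true → (P ∪ Q) x ≡ true
∪-trueʳ P Q {x} e = trans (cong (P x ∨_) e) (∨-zeroʳ (P x))

∪-true⁻ : ∀ P Q {x} → (P ∪ Q) x ≡ true → P x ≡ true ⊎ Q x ≡ true
∪-true⁻ P Q {x} e with P x
... | true  = inj₁ refl
... | false = inj₂ e

-- restrict S is delete (inS S) by definition.
delete : Nails → Word → Word
delete P = filterᵇ (λ x → not (P (proj₁ x)))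

delete-++ : ∀ P u v → delete P (u ++ v) ≡ delete P u ++ delete P v
delete-++ P = filter-++ (λ x → T? (not (P (proj₁ x))))

delete-flipSign : ∀ P x → delete P [ flipSign x ] ≡ inv (delete P [ x ])
delete-flipSign P (a , s) with P a
... | true  = refl
... | false = refl

delete-removed : ∀ P {a} s w → P a ≡ true → delete P ((a , s) ∷ w) ≡ delete P w
delete-removed P {a} s w Pa with P a | Pa
... | true | _ = refl

delete-kept : ∀ P {a} s w → P a ≡ false → delete P ((a , s) ∷ w) ≡ (a , s) ∷ delete P w
delete-kept P {a} s w ¬Pa with P a | ¬Pa
... | false | _ = refl

delete-nothing : ∀ w → delete (λ _ → false) w ≡ w
delete-nothing []      = refl
delete-nothing (x ∷ w) = cong (x ∷_) (delete-nothing w)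

delete-inv : ∀ P w → delete P (inv w) ≡ inv (delete P w)
delete-inv P []      = refl
delete-inv P (x ∷ w) = begin
  delete P (inv (x ∷ w))                         ≡⟨ cong (delete P) (inv-∷ x w) ⟩
  delete P (inv w ++ [ flipSign x ])             ≡⟨ delete-++ P (inv w) _ ⟩
  delete P (inv w) ++ delete P [ flipSign x ]    ≡⟨ cong₂ _++_ (delete-inv P w) (delete-flipSign P x) ⟩
  inv (delete P w) ++ inv (delete P [ x ])       ≡⟨ inv-++ (delete P [ x ]) (delete P w) ⟨
  inv (delete P [ x ] ++ delete P w)             ≡⟨ cong inv (delete-++ P [ x ] w) ⟨
  inv (delete P (x ∷ w))                         ∎
  where open ≡-Reasoning

delete-comm : ∀ P u v → delete P (comm u v) ≡ comm (delete P u) (delete P v)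
delete-comm P u v
  rewrite delete-++ P u (v ++ inv u ++ inv v) | delete-++ P v (inv u ++ inv v)
        | delete-++ P (inv u) (inv v) | delete-inv P u | delete-inv P v = refl

delete-delete : ∀ P Q w → delete Q (delete P w) ≡ delete (P ∪ Q) w
delete-delete P Q []            = refl
delete-delete P Q ((a , s) ∷ w) with P a
... | true  = delete-delete P Q w
... | false with Q a
...   | true  = delete-delete P Q w
...   | false = cong ((a , s) ∷_) (delete-delete P Q w)

delete-push : ∀ P x w → delete P (push x w) ≈ delete P (x ∷ w)
delete-push P x []       = ≈-refl
delete-push P x (y ∷ ys) with cancels x y in c
... | false = ≈-refl
... | true with refl ← cancels⇒flipSign x y c = begin
  delete P ys                                         ≈⟨ ++-cong (pair-vanishes x) ≈-refl ⟨
  delete P (x ∷ flipSign x ∷ []) ++ delete P ys       ≡⟨ delete-++ P (x ∷ flipSign x ∷ []) ys ⟨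
  delete P (x ∷ flipSign x ∷ ys)                      ∎
  where
  open ≈-Reasoning
  pair-vanishes : ∀ x → delete P (x ∷ flipSign x ∷ []) ≈ []
  pair-vanishes x = begin
    delete P (x ∷ flipSign x ∷ [])               ≡⟨ delete-++ P [ x ] [ flipSign x ] ⟩
    delete P [ x ] ++ delete P [ flipSign x ]    ≡⟨ cong (delete P [ x ] ++_) (delete-flipSign P x) ⟩
    delete P [ x ] ++ inv (delete P [ x ])       ≈⟨ ++-inverseʳ (delete P [ x ]) ⟩
    []                                           ∎

delete-reduce : ∀ P w → delete P (reduce w) ≈ delete P w
delete-reduce P []      = ≈-refl
delete-reduce P (x ∷ w) = begin
  delete P (push x (reduce w))           ≈⟨ delete-push P x (reduce w) ⟩
  delete P (x ∷ reduce w)                ≡⟨ delete-++ P [ x ] (reduce w) ⟩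
  delete P [ x ] ++ delete P (reduce w)  ≈⟨ ++-cong ≈-refl (delete-reduce P w) ⟩
  delete P [ x ] ++ delete P w           ≡⟨ delete-++ P [ x ] w ⟨
  delete P (x ∷ w)                       ∎
  where open ≈-Reasoning

delete-cong : ∀ P {u v} → u ≈ v → delete P u ≈ delete P v
delete-cong P {u} {v} (mk≈ p) = begin
  delete P u            ≈⟨ delete-reduce P u ⟨
  delete P (reduce u)   ≡⟨ cong (delete P) p ⟩
  delete P (reduce v)   ≈⟨ delete-reduce P v ⟩
  delete P v            ∎
  where open ≈-Reasoning


-- Commutators and conjugation

Commute : Word → Word → Set
Commute u v = u ++ v ≈ v ++ u

comm≈[]⇒Commute : ∀ u v → comm u v ≈ [] → Commute u v
comm≈[]⇒Commute u v uv≈[] = x∙y⁻¹≈ε⇒x≈y (u ++ v) (v ++ u) (begin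
  (u ++ v) ++ inv (v ++ u)    ≡⟨ cong ((u ++ v) ++_) (inv-++ v u) ⟩
  (u ++ v) ++ inv u ++ inv v  ≡⟨ ++-assoc u v _ ⟩
  comm u v                    ≈⟨ uv≈[] ⟩
  []                          ∎)
  where open ≈-Reasoning

comm-trivialˡ : ∀ {u} v → u ≈ [] → comm u v ≈ []
comm-trivialˡ {u} v u≈[] = begin
  comm u v          ≈⟨ ++-cong u≈[] (++-cong (≈-refl {v}) (++-cong (inv-cong u≈[]) ≈-refl)) ⟩
  v ++ inv v        ≈⟨ ++-inverseʳ v ⟩
  []                ∎
  where open ≈-Reasoning

comm-trivialʳ : ∀ u {v} → v ≈ [] → comm u v ≈ []
comm-trivialʳ u {v} v≈[] = begin
  comm u v              ≈⟨ ++-cong (≈-refl {u}) (++-cong v≈[] (++-cong ≈-refl (inv-cong v≈[]))) ⟩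
  u ++ inv u ++ []      ≡⟨ cong (u ++_) (++-identityʳ (inv u)) ⟩
  u ++ inv u            ≈⟨ ++-inverseʳ u ⟩
  []                    ∎
  where open ≈-Reasoning

conjugate : Word → Word → Word
conjugate g w = inv g ++ w ++ g

conjugate-++ : ∀ g u v → conjugate g (u ++ v) ≈ conjugate g u ++ conjugate g v
conjugate-++ g u v = begin
  inv g ++ (u ++ v) ++ g                     ≡⟨ solve (++-monoid Letter) ⟩
  (inv g ++ u) ++ [] ++ v ++ g               ≈⟨ ++-cong (≈-refl {inv g ++ u}) (++-cong (++-inverseʳ g) ≈-refl) ⟨
  (inv g ++ u) ++ (g ++ inv g) ++ v ++ g     ≡⟨ solve (++-monoid Letter) ⟩
  (inv g ++ u ++ g) ++ (inv g ++ v ++ g)     ∎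
  where open ≈-Reasoning

conjugate-cong : ∀ g {u v} → u ≈ v → conjugate g u ≈ conjugate g v
conjugate-cong g u≈v = ++-cong (≈-refl {inv g}) (++-cong u≈v ≈-refl)

conjugate-inverse : ∀ g w → conjugate (inv g) (conjugate g w) ≈ w
conjugate-inverse g w = begin
  inv (inv g) ++ (inv g ++ w ++ g) ++ inv g  ≡⟨ cong (λ h → h ++ (inv g ++ w ++ g) ++ inv g) (inv-involutive g) ⟩
  g ++ (inv g ++ w ++ g) ++ inv g            ≡⟨ solve (++-monoid Letter) ⟩
  (g ++ inv g) ++ w ++ (g ++ inv g)          ≈⟨ ++-cong (++-inverseʳ g) (++-cong (≈-refl {w}) (++-inverseʳ g)) ⟩
  w ++ []                                    ≡⟨ ++-identityʳ w ⟩
  w                                          ∎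
  where open ≈-Reasoning

conjugate-trivial : ∀ g {w} → conjugate g w ≈ [] → w ≈ []
conjugate-trivial g {w} g⁻¹wg≈[] = begin
  w                                   ≈⟨ conjugate-inverse g w ⟨
  conjugate (inv g) (conjugate g w)   ≈⟨ conjugate-cong (inv g) g⁻¹wg≈[] ⟩
  inv (inv g) ++ inv g                ≈⟨ ++-inverseˡ (inv g) ⟩
  []                                  ∎
  where open ≈-Reasoning

Commute-conjugate : ∀ g {u v} → Commute u v → Commute (conjugate g u) (conjugate g v)
Commute-conjugate g {u} {v} uv≈vu = begin
  conjugate g u ++ conjugate g v   ≈⟨ conjugate-++ g u v ⟨
  conjugate g (u ++ v)             ≈⟨ conjugate-cong g uv≈vu ⟩
  conjugate g (v ++ u)             ≈⟨ conjugate-++ g v u ⟩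
  conjugate g v ++ conjugate g u   ∎
  where open ≈-Reasoning

Commute⇒conjugate-fixed : ∀ {a c} → Commute a c → conjugate a c ≈ c
Commute⇒conjugate-fixed {a} {c} ac≈ca = begin
  inv a ++ c ++ a             ≈⟨ ++-cong (≈-refl {inv a}) ac≈ca ⟨
  inv a ++ a ++ c             ≡⟨ ++-assoc (inv a) a c ⟨
  (inv a ++ a) ++ c           ≈⟨ ++-cong (++-inverseˡ a) ≈-refl ⟩
  c                           ∎
  where open ≈-Reasoning

Commute-cong : ∀ {u u′ v v′} → u ≈ u′ → v ≈ v′ → Commute u v → Commute u′ v′
Commute-cong u≈u′ v≈v′ uv≈vu = ≈-trans (≈-sym (++-cong u≈u′ v≈v′)) (≈-trans uv≈vu (++-cong v≈v′ u≈u′))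

Commute-inv : ∀ {a c} → Commute a c → Commute a (inv c)
Commute-inv {a} {c} ac≈ca = begin
  a ++ inv c                          ≈⟨ ++-cong (++-inverseˡ c) ≈-refl ⟨
  (inv c ++ c) ++ a ++ inv c          ≡⟨ solve (++-monoid Letter) ⟩
  inv c ++ (c ++ a) ++ inv c          ≈⟨ ++-cong (≈-refl {inv c}) (++-cong ac≈ca ≈-refl) ⟨
  inv c ++ (a ++ c) ++ inv c          ≡⟨ solve (++-monoid Letter) ⟩
  (inv c ++ a) ++ (c ++ inv c)        ≈⟨ ++-cong ≈-refl (++-inverseʳ c) ⟩
  (inv c ++ a) ++ []                  ≡⟨ ++-identityʳ _ ⟩
  inv c ++ a                          ∎
  where open ≈-Reasoning

conjugate-rotate : ∀ p u w → conjugate u (w ++ p) ≈ conjugate (p ++ u) (p ++ w)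
conjugate-rotate p u w = begin
  inv u ++ (w ++ p) ++ u                     ≡⟨ solve (++-monoid Letter) ⟩
  inv u ++ [] ++ w ++ p ++ u                 ≈⟨ ++-cong (≈-refl {inv u}) (++-cong (++-inverseˡ p) ≈-refl) ⟨
  inv u ++ (inv p ++ p) ++ w ++ p ++ u       ≡⟨ solve (++-monoid Letter) ⟩
  (inv u ++ inv p) ++ (p ++ w) ++ p ++ u     ≡⟨ cong (λ h → h ++ (p ++ w) ++ p ++ u) (inv-++ p u) ⟨
  inv (p ++ u) ++ (p ++ w) ++ p ++ u         ∎
  where open ≈-Reasoning

delete-conjugate : ∀ P g w → delete P (conjugate g w) ≡ conjugate (delete P g) (delete P w)
delete-conjugate P g w rewrite delete-++ P (inv g) (w ++ g) | delete-++ P w g | delete-inv P g = refl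

-- Reduced words

Junction : Word → Word → Set
Junction u v = Connected NonCancelling (last u) (head v)

last-++ : ∀ (u : Word) {y v} → last (u ++ y ∷ v) ≡ last (y ∷ v)
last-++ []           = refl
last-++ (x ∷ [])     = refl
last-++ (x ∷ x′ ∷ u) = last-++ (x′ ∷ u)

last-inv-∷ : ∀ x a → last (inv (x ∷ a)) ≡ just (flipSign x)
last-inv-∷ x a = trans (cong last (inv-∷ x a)) (last-++ (inv a) {flipSign x} {[]})

Junction-[]ˡ : ∀ v → Junction [] v
Junction-[]ˡ []      = nothing
Junction-[]ˡ (_ ∷ _) = nothing-just

Reduced-++⁻ : ∀ u {v} → Reduced (u ++ v) → Reduced u × Junction u v × Reduced v
Reduced-++⁻ []                   r        = [] , Junction-[]ˡ _ , r
Reduced-++⁻ (x ∷ [])     {[]}    r        = [-] , just-nothing , []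
Reduced-++⁻ (x ∷ [])     {y ∷ v} (nc ∷ r) = [-] , just nc , r
Reduced-++⁻ (x ∷ x′ ∷ u)         (nc ∷ r) with Reduced-++⁻ (x′ ∷ u) r
... | ru , j , rv = nc ∷ ru , j , rv

Reduced-inv : ∀ {w} → Reduced w → Reduced (inv w)
Reduced-inv []  = []
Reduced-inv [-] = [-]
Reduced-inv {x ∷ y ∷ w} (nc ∷ r) = subst Reduced (sym (inv-∷ x (y ∷ w)))
  (++⁺ (Reduced-inv r) junction [-])
  where
  junction : Junction (inv (y ∷ w)) [ flipSign x ]
  junction = subst (λ m → Connected NonCancelling m (just (flipSign x))) (sym (last-inv-∷ y w))
                   (just (noncancelling-flipSign {x} {y} nc))

≈⇒≡ : ∀ {u v} → Reduced u → Reduced v → u ≈ v → u ≡ v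
≈⇒≡ {u} {v} ru rv (mk≈ p) = trans (sym (reduce-Reduced-id ru)) (trans p (reduce-Reduced-id rv))

Reduced-conjugate : ∀ {a y w} → Reduced a → Reduced (y ∷ w) →
                    Junction (inv a) (y ∷ w) → Junction (y ∷ w) a →
                    Reduced (conjugate a (y ∷ w))
Reduced-conjugate ra rw j₁ j₂ = ++⁺ (Reduced-inv ra) j₁ (++⁺ rw j₂ ra)

length-conjugate : ∀ g w → length (conjugate g w) ≡ length g + length w + length g
length-conjugate g w = begin
  length (inv g ++ w ++ g)                 ≡⟨ length-++ (inv g) ⟩
  length (inv g) + length (w ++ g)         ≡⟨ cong₂ _+_ (length-inv g) (length-++ w) ⟩
  length g + (length w + length g)         ≡⟨ +-assoc (length g) _ _ ⟨
  length g + length w + length g           ∎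
  where open ≡-Reasoning

-- Reduced as written, the conjugate is longer than w, hence than w′.
Reduced-conjugate-≉ : ∀ {x a w w′} → Reduced (conjugate (x ∷ a) w) → Reduced w′ →
                      length w ≡ length w′ → ¬ (conjugate (x ∷ a) w ≈ w′)
Reduced-conjugate-≉ {x} {a} {w} {w′} r r′ |w|≡|w′| eq = <⇒≢ |w′|<|w′| refl
  where
  open ≤-Reasoning
  |w′|<|w′| : length w′ < length w′
  |w′|<|w′| = begin-strict
    length w′                                   ≡⟨ |w|≡|w′| ⟨
    length w                                    <⟨ m<n+m (length w) z<s ⟩
    length (x ∷ a) + length w                   ≤⟨ m≤m+n _ _ ⟩
    length (x ∷ a) + length w + length (x ∷ a)  ≡⟨ length-conjugate (x ∷ a) w ⟨
    length (conjugate (x ∷ a) w)                ≡⟨ cong length (≈⇒≡ r r′ eq) ⟩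
    length w′                                   ∎

Reduced-rotate : ∀ p w → Reduced ((p ++ w) ++ (p ++ w)) → Reduced (w ++ p)
Reduced-rotate p w r = proj₁ (Reduced-++⁻ (w ++ p) (proj₂ (proj₂ (Reduced-++⁻ p (subst Reduced pwpw≡p[wp]w r)))))
  where
  pwpw≡p[wp]w : (p ++ w) ++ (p ++ w) ≡ p ++ (w ++ p) ++ w
  pwpw≡p[wp]w = solve (++-monoid Letter)

-- Cyclic reduction, powers and roots

CyclicallyReduced : Word → Set
CyclicallyReduced c = c ≢ [] × Reduced (c ++ c)

CyclicallyReduced-inv : ∀ {c} → CyclicallyReduced c → CyclicallyReduced (inv c)
CyclicallyReduced-inv {c} (c≢[] , rcc) =
  (λ c⁻¹≡[] → c≢[] (trans (sym (inv-involutive c)) (cong inv c⁻¹≡[])))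
  , subst Reduced (inv-++ c c) (Reduced-inv rcc)

infixr 8 _^ʷ_
_^ʷ_ : Word → ℕ → Word
w ^ʷ zero  = []
w ^ʷ suc k = w ++ w ^ʷ k

^ʷ-+ : ∀ w m n → w ^ʷ (m + n) ≡ w ^ʷ m ++ w ^ʷ n
^ʷ-+ w zero    n = refl
^ʷ-+ w (suc m) n = trans (cong (w ++_) (^ʷ-+ w m n)) (sym (++-assoc w (w ^ʷ m) (w ^ʷ n)))

^ʷ-cong : ∀ k {u v} → u ≈ v → u ^ʷ k ≈ v ^ʷ k
^ʷ-cong zero    _   = ≈-refl
^ʷ-cong (suc k) u≈v = ++-cong u≈v (^ʷ-cong k u≈v)

^ʷ-trivial : ∀ k {u} → u ≈ [] → u ^ʷ k ≈ []
^ʷ-trivial zero    _    = ≈-refl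
^ʷ-trivial (suc k) u≈[] = ++-cong u≈[] (^ʷ-trivial k u≈[])

delete-^ʷ : ∀ P w k → delete P (w ^ʷ k) ≡ delete P w ^ʷ k
delete-^ʷ P w zero    = refl
delete-^ʷ P w (suc k) = trans (delete-++ P w (w ^ʷ k)) (cong (delete P w ++_) (delete-^ʷ P w k))

conjugate-^ʷ : ∀ g w k → conjugate g (w ^ʷ k) ≈ conjugate g w ^ʷ k
conjugate-^ʷ g w zero    = ++-inverseˡ g
conjugate-^ʷ g w (suc k) = ≈-trans (conjugate-++ g w (w ^ʷ k)) (++-cong ≈-refl (conjugate-^ʷ g w k))

last-^ʷ : ∀ y v k → last ((y ∷ v) ^ʷ suc k) ≡ last (y ∷ v)
last-^ʷ y v zero    = cong last (++-identityʳ (y ∷ v))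
last-^ʷ y v (suc k) = trans (last-++ (y ∷ v)) (last-^ʷ y v k)

Reduced-^ʷ : ∀ {c} k → CyclicallyReduced c → Reduced (c ^ʷ suc k)
Reduced-^ʷ {[]}    _       (c≢[] , _)  = contradiction refl c≢[]
Reduced-^ʷ {y ∷ v} zero    (_ , rcc)   =
  subst Reduced (sym (++-identityʳ (y ∷ v))) (proj₁ (Reduced-++⁻ (y ∷ v) rcc))
Reduced-^ʷ {y ∷ v} (suc k) cr@(_ , rcc) with Reduced-++⁻ (y ∷ v) rcc
... | rc , jcc , _ = ++⁺ rc jcc (Reduced-^ʷ k cr)

cyclic-decomposition : ∀ n {b} → length b ≤ n → Reduced b → b ≢ [] →
                       ∃[ g ] ∃[ c ] b ≡ conjugate g c × CyclicallyReduced c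
cyclic-decomposition n       {[]}     _ _ b≢[] = contradiction refl b≢[]
cyclic-decomposition (suc n) {x ∷ b′} (s≤s |b′|≤n) r _ with initLast b′
... | []      = [] , [ x ] , refl , (λ ()) , noncancelling x≢x⁻¹ ∷ [-]
  where
  x≢x⁻¹ : x ≢ flipSign x
  x≢x⁻¹ x≡x⁻¹ = not-¬ refl (cong proj₂ x≡x⁻¹)
... | m ∷ʳ′ y with cancels y x in yx
...   | false = [] , x ∷ m ∷ʳ y , sym (++-identityʳ _) , (λ ()) , ++⁺ r junction r
  where
  junction : Junction (x ∷ m ∷ʳ y) (x ∷ m ∷ʳ y)
  junction = subst (λ l → Connected NonCancelling l (just x)) (sym (last-++ (x ∷ m) {y} {[]})) (just yx)
...   | true with refl ← cancels⇒flipSign y x yx with m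
...     | [] = contradiction (trans (sym (cancels-flipSignˡ y)) (Linked.head r)) λ ()
...     | m@(_ ∷ _) with cyclic-decomposition n {m} (≤-trans (length-++-≤ˡ m) |b′|≤n)
                                             (proj₁ (Reduced-++⁻ m (Linked.tail r))) (λ ())
...       | g , c , m≡g⁻¹cg , cr = g ∷ʳ y , c , b≡ , cr
  where
  b≡ : flipSign y ∷ m ∷ʳ y ≡ conjugate (g ∷ʳ y) c
  b≡ = begin
    flipSign y ∷ m ∷ʳ y                     ≡⟨ cong (λ h → flipSign y ∷ h ∷ʳ y) m≡g⁻¹cg ⟩
    flipSign y ∷ (inv g ++ c ++ g) ∷ʳ y     ≡⟨ cong (flipSign y ∷_) (solve (++-monoid Letter)) ⟩
    flipSign y ∷ inv g ++ c ++ g ∷ʳ y       ≡⟨ cong (_++ c ++ g ∷ʳ y) (inv-++ g [ y ]) ⟨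
    inv (g ∷ʳ y) ++ c ++ g ∷ʳ y             ∎
    where open ≡-Reasoning

^ʷ-torsion-free : ∀ r m → r ^ʷ suc m ≈ [] → r ≈ []
^ʷ-torsion-free r m rᵐ⁺¹≈[] with reduce r in r↓
... | [] = mk≈ r↓
... | z ∷ zs with cyclic-decomposition _ ≤-refl (subst Reduced r↓ (reduce-Reduced r)) (λ ())
...   | g , [] , _ , c≢[] , _ = contradiction refl c≢[]
...   | g , c@(y ∷ v) , z∷zs≡g⁻¹cg , cr@(_ , rcc) =
  contradiction (++-conicalʳ (inv g) _ (≈⇒≡ reduced [] trivial)) λ ()
  where
  W = conjugate g (c ^ʷ suc m)
  trivial : W ≈ []
  trivial = begin
    conjugate g (c ^ʷ suc m)   ≈⟨ conjugate-^ʷ g c (suc m) ⟩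
    conjugate g c ^ʷ suc m     ≡⟨ cong (_^ʷ suc m) z∷zs≡g⁻¹cg ⟨
    (z ∷ zs) ^ʷ suc m          ≡⟨ cong (_^ʷ suc m) r↓ ⟨
    reduce r ^ʷ suc m          ≈⟨ ^ʷ-cong (suc m) (reduce-≈ r) ⟩
    r ^ʷ suc m                 ≈⟨ rᵐ⁺¹≈[] ⟩
    []                         ∎
    where open ≈-Reasoning
  reduced : Reduced W
  reduced with Reduced-++⁻ (inv g) (subst Reduced z∷zs≡g⁻¹cg (subst Reduced r↓ (reduce-Reduced r)))
  ... | rg⁻¹ , j₁ , rcg with Reduced-++⁻ c rcg
  ... | _ , j₂ , rg = ++⁺ rg⁻¹ j₁ (++⁺ (Reduced-^ʷ m cr) j₂′ rg)
    where
    j₂′ : Junction (c ^ʷ suc m) g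
    j₂′ = subst (λ l → Connected NonCancelling l (head g)) (sym (last-^ʷ y v m)) j₂

CommonRoot : Word → Word → Set
CommonRoot u v = ∃[ r ] ∃[ i ] ∃[ k ] u ≡ r ^ʷ suc i × v ≡ r ^ʷ suc k

prefix-of-longer : ∀ (xs : Word) {ys zs ws} → xs ++ ys ≡ zs ++ ws → length xs ≤ length zs →
                   ∃[ d ] zs ≡ xs ++ d
prefix-of-longer []       _  _ = _ , refl
prefix-of-longer (x ∷ xs) {zs = z ∷ zs} eq (s≤s |xs|≤|zs|)
  with refl , eq′ ← ∷-injective eq
  with d , refl ← prefix-of-longer xs {zs = zs} eq′ |xs|≤|zs| = d , refl

-- Lyndon–Schützenberger, by Euclid's algorithm on the lengths.
commuting-words-common-root : ∀ n {u v} → length u + length v ≤ n → u ≢ [] → v ≢ [] →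
                              u ++ v ≡ v ++ u → CommonRoot u v
commuting-words-common-root-≤ : ∀ n {u v} → length u ≤ length v → length u + length v ≤ n →
                                u ≢ [] → v ≢ [] → u ++ v ≡ v ++ u → CommonRoot u v

commuting-words-common-root n {u} {v} size u≢[] v≢[] uv≡vu with ≤-total (length u) (length v)
... | inj₁ |u|≤|v| = commuting-words-common-root-≤ n |u|≤|v| size u≢[] v≢[] uv≡vu
... | inj₂ |v|≤|u|
  with r , i , k , v≡ , u≡ ← commuting-words-common-root-≤ n |v|≤|u|
         (subst (_≤ n) (+-comm (length u) (length v)) size) v≢[] u≢[] (sym uv≡vu)
  = r , k , i , u≡ , v≡

commuting-words-common-root-≤ n {[]} _ _ u≢[] _ _ = contradiction refl u≢[]
commuting-words-common-root-≤ n {u@(x ∷ u′)} {v} |u|≤|v| size _ _ uv≡vu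
  with prefix-of-longer u {zs = v} uv≡vu |u|≤|v|
... | [] , refl = u , 0 , 0 , sym (++-identityʳ u) , refl
... | d@(_ ∷ _) , refl with n | size
...   | suc n′ | s≤s size′ =
  extend (commuting-words-common-root n′ {u} {d} (≤-trans smaller size′) (λ ()) (λ ()) ud≡du)
  where
  extend : CommonRoot u d → CommonRoot u (u ++ d)
  extend (r , i , k , u≡ , d≡) = r , i , i + suc k , u≡ , trans (cong₂ _++_ u≡ d≡) (sym (^ʷ-+ r (suc i) (suc k)))
  ud≡du : u ++ d ≡ d ++ u
  ud≡du = ++-cancelˡ u _ _ (trans uv≡vu (++-assoc u d u))
  smaller : length u + length d ≤ length u′ + length (u ++ d)
  smaller = begin
    length u + length d             ≡⟨ +-suc (length u′) (length d) ⟨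
    length u′ + suc (length d)      ≤⟨ +-monoʳ-≤ (length u′) (s≤s (length-++-≤ʳ d {u′})) ⟩
    length u′ + length (u ++ d)     ∎
    where open ≤-Reasoning

-- Centralisers

data Overlap : Word → Word → Set where
  second-is-prefix       : ∀ c a₁ → Overlap (c ++ a₁) c
  first-is-proper-prefix : ∀ a y v → Overlap a (a ++ y ∷ v)
  branch                 : ∀ p {h y} a₁ v → h ≢ y → Overlap (p ++ h ∷ a₁) (p ++ y ∷ v)

compare-prefixes : ∀ a c → Overlap a c
compare-prefixes a       []      = second-is-prefix [] a
compare-prefixes []      (y ∷ v) = first-is-proper-prefix [] y v
compare-prefixes (x ∷ a) (y ∷ c) with ≡-dec _≟_ Bool._≟_ x y
... | no x≢y   = branch [] a c x≢y
... | yes refl with compare-prefixes a c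
...   | second-is-prefix c a₁       = second-is-prefix (x ∷ c) a₁
...   | first-is-proper-prefix a y v = first-is-proper-prefix (x ∷ a) y v
...   | branch p a₁ v h≢y          = branch (x ∷ p) a₁ v h≢y

killed-conjugate : ∀ K g {w} → delete K w ≈ [] → delete K (conjugate g w) ≈ []
killed-conjugate K g {w} Kw = begin
  delete K (conjugate g w)                     ≡⟨ delete-conjugate K g w ⟩
  conjugate (delete K g) (delete K w)          ≈⟨ conjugate-cong (delete K g) Kw ⟩
  conjugate (delete K g) []                    ≈⟨ ++-inverseˡ (delete K g) ⟩
  []                                           ∎
  where open ≈-Reasoning

killed-conjugate⁻ : ∀ K g {w} → delete K (conjugate g w) ≈ [] → delete K w ≈ []
killed-conjugate⁻ K g {w} Kgw =
  conjugate-trivial (delete K g) (≈-trans (≡⇒≈ (sym (delete-conjugate K g w))) Kgw)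

-- a and a ++ v commute, so a ++ v ≡ v ++ a as reduced words, and a, v are powers of a root r;
-- K kills a power of r, hence r by torsion-freeness, hence a.
proper-prefix-killed : ∀ K {a v} → a ≢ [] → v ≢ [] → CyclicallyReduced (a ++ v) →
                       Commute a (a ++ v) → delete K (a ++ v) ≈ [] → delete K a ≈ []
proper-prefix-killed K {a} {v} a≢[] v≢[] (_ , r-avav) a-commutes Kav =
  root-killed (commuting-words-common-root _ ≤-refl a≢[] v≢[] av≡va)
  where
  av≈va : a ++ v ≈ v ++ a
  av≈va = ∙-cancelˡ a _ _ (≈-trans a-commutes (≡⇒≈ (++-assoc a v a)))
  avav≡a[va]v : (a ++ v) ++ (a ++ v) ≡ a ++ (v ++ a) ++ v
  avav≡a[va]v = solve (++-monoid Letter)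
  av≡va : a ++ v ≡ v ++ a
  av≡va with Reduced-++⁻ a (subst Reduced avav≡a[va]v r-avav)
  ... | _ , _ , r-vav = ≈⇒≡ (proj₁ (Reduced-++⁻ (a ++ v) r-avav)) (proj₁ (Reduced-++⁻ (v ++ a) r-vav)) av≈va
  root-killed : CommonRoot a v → delete K a ≈ []
  root-killed (r , i , k , a≡rⁱ⁺¹ , v≡rᵏ⁺¹) = begin
    delete K a                  ≡⟨ cong (delete K) a≡rⁱ⁺¹ ⟩
    delete K (r ^ʷ suc i)       ≡⟨ delete-^ʷ K r (suc i) ⟩
    delete K r ^ʷ suc i         ≈⟨ ^ʷ-trivial (suc i) (^ʷ-torsion-free (delete K r) (i + suc k) Kr) ⟩
    []                          ∎
    where
    open ≈-Reasoning
    Kr : delete K r ^ʷ (suc i + suc k) ≈ []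
    Kr = begin
      delete K r ^ʷ (suc i + suc k)          ≡⟨ delete-^ʷ K r (suc i + suc k) ⟨
      delete K (r ^ʷ (suc i + suc k))        ≡⟨ cong (delete K) (^ʷ-+ r (suc i) (suc k)) ⟩
      delete K (r ^ʷ suc i ++ r ^ʷ suc k)    ≡⟨ cong (delete K) (cong₂ _++_ a≡rⁱ⁺¹ v≡rᵏ⁺¹) ⟨
      delete K (a ++ v)                      ≈⟨ Kav ⟩
      []                                     ∎

++-longerʳ : ∀ (c : Word) {a} → c ≢ [] → length a < length (c ++ a)
++-longerʳ []      c≢[] = contradiction refl c≢[]
++-longerʳ (_ ∷ c) _    = s≤s (length-++-≤ʳ _ {c})

snoc-view : ∀ (y : Letter) c → ∃[ m ] ∃[ z ] y ∷ c ≡ m ∷ʳ z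
snoc-view y []       = [] , y , refl
snoc-view y (y′ ∷ c) with m , z , eq ← snoc-view y′ c = y ∷ m , z , cong (y ∷_) eq

-- If c is a prefix of a, recurse on the rest of a.  If a and c branch after a common prefix
-- p (nonempty, as they start alike), then a₁⁻¹ (v p) a₁ ≈ c is reduced as written.
cyclic-centralizer-killed-same-head :
  ∀ K {a c} → (∀ {a₁} → length a₁ < length a → Reduced a₁ → Commute a₁ c → delete K a₁ ≈ []) →
  a ≢ [] → head a ≡ head c → Reduced a → CyclicallyReduced c → Commute a c →
  delete K c ≈ [] → delete K a ≈ []
cyclic-centralizer-killed-same-head K {a} {c} IH a≢[] same-head ra cr@(c≢[] , rcc) ac≈ca Kc
  with compare-prefixes a c
... | second-is-prefix c a₁ = ≈-trans (≡⇒≈ (delete-++ K c a₁)) (++-cong Kc (IH shorter ra₁ a₁c≈ca₁))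
  where
  shorter : length a₁ < length (c ++ a₁)
  shorter = ++-longerʳ c c≢[]
  ra₁ = proj₂ (proj₂ (Reduced-++⁻ c ra))
  a₁c≈ca₁ : Commute a₁ c
  a₁c≈ca₁ = ∙-cancelˡ c _ _ (≈-trans (≡⇒≈ (sym (++-assoc c a₁ c))) ac≈ca)
... | first-is-proper-prefix a y v = proper-prefix-killed K a≢[] (λ ()) cr ac≈ca Kc
... | branch [] a₁ v h≢y = contradiction (just-injective same-head) h≢y
... | branch p@(p₀ ∷ p′) {h} {y} a₁ v h≢y =
  contradiction (≈-trans (conjugate-rotate p (h ∷ a₁) (y ∷ v)) (Commute⇒conjugate-fixed ac≈ca))
    (Reduced-conjugate-≉ reduced (proj₁ (Reduced-++⁻ c rcc)) (length-++-comm (y ∷ v) p))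
  where
  reduced : Reduced (conjugate (h ∷ a₁) ((y ∷ v) ++ p))
  reduced with Reduced-++⁻ p ra
  ... | _ , jpu , ru = Reduced-conjugate ru (Reduced-rotate p (y ∷ v) rcc)
    (subst (λ l → Connected NonCancelling l (just y)) (sym (last-inv-∷ h a₁))
           (just (noncancelling λ y≡h⁻¹⁻¹ → h≢y (sym (trans y≡h⁻¹⁻¹ (flipSign-involutive h))))))
    (subst (λ l → Connected NonCancelling l (just h)) (sym (last-++ (y ∷ v) {p₀} {p′})) jpu)

-- Unless a starts with the first letter of c or of c⁻¹ (the previous lemma), a⁻¹ c a ≈ c is
-- reduced as written.
cyclic-centralizer-killed : ∀ K n {a c} → length a ≤ n → Reduced a → CyclicallyReduced c →
                            Commute a c → delete K c ≈ [] → delete K a ≈ []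
cyclic-centralizer-killed K n       {[]}              _ _ _ _ _ = ≈-refl
cyclic-centralizer-killed K n       {_ ∷ _} {[]}      _ _ (c≢[] , _) _ _ = contradiction refl c≢[]
cyclic-centralizer-killed K (suc n) {a@(x ∷ a′)} {c@(y ∷ c′)} (s≤s |a′|≤n) ra cr ac≈ca Kc =
  by-first-letters (cancels (flipSign x) y) refl
  where
  IH : ∀ {c} → CyclicallyReduced c → delete K c ≈ [] →
       ∀ {a₁} → length a₁ < length a → Reduced a₁ → Commute a₁ c → delete K a₁ ≈ []
  IH cr Kc (s≤s |a₁|≤|a′|) ra₁ a₁c≈ca₁ =
    cyclic-centralizer-killed K n (≤-trans |a₁|≤|a′| |a′|≤n) ra₁ cr a₁c≈ca₁ Kc

  by-last-letters : (∃[ m ] ∃[ z ] c ≡ m ∷ʳ z) → NonCancelling (flipSign x) y → delete K a ≈ []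
  by-last-letters (m , z , c≡mz) x⁻¹y with cancels z x in zx
  ... | true = cyclic-centralizer-killed-same-head K (IH cr⁻¹ Kc⁻¹) (λ ()) same-head ra cr⁻¹
                 (Commute-inv {a} {c} ac≈ca) Kc⁻¹
    where
    cr⁻¹ : CyclicallyReduced (inv c)
    cr⁻¹ = CyclicallyReduced-inv cr
    same-head : just x ≡ head (inv c)
    same-head = trans (cong just (cancels⇒flipSign z x zx)) (cong head (sym (trans (cong inv c≡mz) (inv-++ m [ z ]))))
    Kc⁻¹ : delete K (inv c) ≈ []
    Kc⁻¹ = ≈-trans (≡⇒≈ (delete-inv K c)) (inv-cong Kc)
  ... | false = contradiction (Commute⇒conjugate-fixed ac≈ca)
                  (Reduced-conjugate-≉ (Reduced-conjugate ra rc j₁ j₂) rc refl)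
    where
    rc = proj₁ (Reduced-++⁻ c (proj₂ cr))
    j₁ : Junction (inv a) c
    j₁ = subst (λ l → Connected NonCancelling l (just y)) (sym (last-inv-∷ x a′)) (just x⁻¹y)
    j₂ : Junction c a
    j₂ = subst (λ l → Connected NonCancelling l (just x))
               (sym (trans (cong last c≡mz) (last-++ m {z} {[]}))) (just zx)

  by-first-letters : ∀ b → cancels (flipSign x) y ≡ b → delete K a ≈ []
  by-first-letters true  x⁻¹y = cyclic-centralizer-killed-same-head K (IH cr Kc) (λ ()) same-head ra cr ac≈ca Kc
    where
    same-head : just x ≡ just y
    same-head = cong just (trans (sym (flipSign-involutive x)) (sym (cancels⇒flipSign _ _ x⁻¹y)))
  by-first-letters false x⁻¹y = by-last-letters (snoc-view y c′) x⁻¹y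

-- Conjugate b to its cyclically reduced core c; the conjugate of a still commutes with c.
commuting-killed : ∀ K {a b} → Commute a b → ¬ b ≈ [] → delete K b ≈ [] → delete K a ≈ []
commuting-killed K {a} {b} ab≈ba b≉[] Kb with reduce b in b↓
... | [] = contradiction (mk≈ b↓) b≉[]
... | z ∷ zs with cyclic-decomposition _ ≤-refl (subst Reduced b↓ (reduce-Reduced b)) (λ ())
...   | g , c , z∷zs≡g⁻¹cg , cr =
  killed-conjugate⁻ K g⁻¹ (≈-trans (delete-cong K (≈-sym (reduce-≈ (conjugate g⁻¹ a)))) Ka′)
  where
  g⁻¹ = inv g
  c≈ : conjugate g⁻¹ b ≈ c
  c≈ = begin
    conjugate g⁻¹ b                   ≈⟨ conjugate-cong g⁻¹ (reduce-≈ b) ⟨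
    conjugate g⁻¹ (reduce b)          ≡⟨ cong (conjugate g⁻¹) (trans b↓ z∷zs≡g⁻¹cg) ⟩
    conjugate g⁻¹ (conjugate g c)     ≈⟨ conjugate-inverse g c ⟩
    c                                 ∎
    where open ≈-Reasoning
  Ka′ : delete K (reduce (conjugate g⁻¹ a)) ≈ []
  Ka′ = cyclic-centralizer-killed K _ ≤-refl (reduce-Reduced (conjugate g⁻¹ a)) cr
          (Commute-cong (≈-sym (reduce-≈ (conjugate g⁻¹ a))) c≈ (Commute-conjugate g⁻¹ ab≈ba))
          (≈-trans (delete-cong K (≈-sym c≈)) (killed-conjugate K g⁻¹ Kb))

-- Falling and holding

record Falls (P : Nails) (w : Word) : Set where
  constructor falls
  field delete≈[] : delete P w ≈ []

Holds : Nails → Word → Set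
Holds P w = ¬ Falls P w

falls-commˡ : ∀ {P u} v → Falls P u → Falls P (comm u v)
falls-commˡ {P} {u} v (falls Pu) = falls (≈-trans (≡⇒≈ (delete-comm P u v)) (comm-trivialˡ (delete P v) Pu))

falls-commʳ : ∀ {P} u {v} → Falls P v → Falls P (comm u v)
falls-commʳ {P} u {v} (falls Pv) = falls (≈-trans (≡⇒≈ (delete-comm P u v)) (comm-trivialʳ (delete P u) Pv))

falls-++ : ∀ {P u v} → Falls P u → Falls P v → Falls P (u ++ v)
falls-++ {P} {u} {v} (falls Pu) (falls Pv) = falls (≈-trans (≡⇒≈ (delete-++ P u v)) (++-cong Pu Pv))

falls-∪ : ∀ {P} Q {w} → Falls P w → Falls (P ∪ Q) w
falls-∪ {P} Q {w} (falls Pw) = falls (≈-trans (≡⇒≈ (sym (delete-delete P Q w))) (delete-cong Q Pw))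

falls-++⁻ˡ : ∀ {P u v} → Falls P v → Falls P (u ++ v) → Falls P u
falls-++⁻ˡ {P} {u} {v} (falls Pv) (falls Puv) = falls (begin
  delete P u                  ≡⟨ ++-identityʳ (delete P u) ⟨
  delete P u ++ []            ≈⟨ ++-cong ≈-refl Pv ⟨
  delete P u ++ delete P v    ≡⟨ delete-++ P u v ⟨
  delete P (u ++ v)           ≈⟨ Puv ⟩
  []                          ∎)
  where open ≈-Reasoning

falls-++⁻ʳ : ∀ {P u v} → Falls P u → Falls P (u ++ v) → Falls P v
falls-++⁻ʳ {P} {u} {v} (falls Pu) (falls Puv) =
  falls (≈-trans (++-cong (≈-sym Pu) ≈-refl) (≈-trans (≡⇒≈ (sym (delete-++ P u v))) Puv))

Separates : Nails → Word → Word → Set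
Separates P a b = ∃[ K ] Falls (P ∪ K) a × Holds (P ∪ K) b

++-holds : ∀ {P a b} → Separates P a b → Holds P (a ++ b) × Holds P (b ++ a)
++-holds {P} (K , PKa , PKb) =
  (λ Pab → PKb (falls-++⁻ʳ PKa (falls-∪ K Pab))) , (λ Pba → PKb (falls-++⁻ˡ PKa (falls-∪ K Pba)))

-- If [a, b] fell under P, the images of a and b would commute; removing K kills the
-- nontrivial image of a, hence also that of b.
comm-holds : ∀ {P a b} → Holds P a → Separates P a b → Holds P (comm a b) × Holds P (comm b a)
comm-holds {P} {a} {b} Pa (K , falls PKa , PKb) =
  holds-if {comm a b} (λ Pab → ≈-sym (commutes a b Pab)) , holds-if {comm b a} (commutes b a)
  where
  commutes : ∀ u v → Falls P (comm u v) → Commute (delete P u) (delete P v)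
  commutes u v (falls Puv) = comm≈[]⇒Commute (delete P u) (delete P v) (≈-trans (≡⇒≈ (sym (delete-comm P u v))) Puv)
  holds-if : ∀ {w} → (Falls P w → Commute (delete P b) (delete P a)) → Holds P w
  holds-if commute Pw = PKb (falls (≈-trans (≡⇒≈ (sym (delete-delete P K b)))
    (commuting-killed K (commute Pw) (Pa ∘ falls) (≈-trans (≡⇒≈ (delete-delete P K a)) PKa))))

-- Blocks of nails

record Block (s t x : ℕ) : Set where
  constructor block
  field
    above : s < x
    below : x ≤ s + 2 ^ t

2^-suc : ∀ t → 2 ^ suc t ≡ 2 ^ t + 2 ^ t
2^-suc t = cong (2 ^ t +_) (+-identityʳ (2 ^ t))

block-first : ∀ s t → Block s t (suc s)
block-first s t = block (n<1+n s) (m<m+n s (m^n>0 2 t))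

block-second : ∀ s t → Block s (suc t) (suc (suc s))
block-second s t = block (m<n⇒m<1+n (n<1+n s)) (begin
  2 + s            ≤⟨ +-monoˡ-≤ s (^-monoʳ-≤ 2 {1} {suc t} (s≤s z≤n)) ⟩
  2 ^ suc t + s    ≡⟨ +-comm (2 ^ suc t) s ⟩
  s + 2 ^ suc t    ∎)
  where open ≤-Reasoning

right-half : ∀ s t → s + 2 ^ t + 2 ^ t ≡ s + 2 ^ suc t
right-half s t = trans (+-assoc s (2 ^ t) (2 ^ t)) (cong (s +_) (sym (2^-suc t)))

block-left : ∀ {s t x} → Block s t x → Block s (suc t) x
block-left {s} {t} (block s<x x≤) =
  block s<x (≤-trans x≤ (+-monoʳ-≤ s (subst (2 ^ t ≤_) (sym (2^-suc t)) (m≤m+n (2 ^ t) (2 ^ t)))))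

block-right : ∀ {s t x} → Block (s + 2 ^ t) t x → Block s (suc t) x
block-right {s} {t} {x} (block m<x x≤) = block (≤-<-trans (m≤m+n s (2 ^ t)) m<x) (subst (x ≤_) (right-half s t) x≤)

block-split : ∀ {s t x} → Block s (suc t) x → Block s t x ⊎ Block (s + 2 ^ t) t x
block-split {s} {t} {x} (block s<x x≤) with x ≤? s + 2 ^ t
... | yes x≤m = inj₁ (block s<x x≤m)
... | no  x≰m = inj₂ (block (≰⇒> x≰m) (subst (x ≤_) (sym (right-half s t)) x≤))

block-disjoint : ∀ {s t x} → Block s t x → ¬ Block (s + 2 ^ t) t x
block-disjoint (block _ x≤m) (block m<x _) = <-irrefl refl (<-≤-trans m<x x≤m)

block-zero : ∀ {s x} → Block s 0 x → x ≡ suc s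
block-zero {s} {x} (block s<x x≤) = ≤-antisym (subst (x ≤_) (+-comm s 1) x≤) s<x

Hits : Nails → ℕ → ℕ → Set
Hits P s t = ∃[ x ] Block s t x × P x ≡ true

Misses : Nails → ℕ → ℕ → Set
Misses P s t = ∀ {x} → Block s t x → P x ≡ false

AtMostOne : Nails → ℕ → ℕ → Set
AtMostOne P s t = ∀ {x y} → Block s t x → Block s t y → P x ≡ true → P y ≡ true → x ≡ y

hits? : ∀ P s t → Hits P s t ⊎ Misses P s t
hits? P s t with anyUpTo? (λ x → (s <? x) ×-dec (P x Bool.≟ true)) (suc (s + 2 ^ t))
... | yes (x , s≤s x≤ , s<x , Px) = inj₁ (x , block s<x x≤ , Px)
... | no none = inj₂ λ {x} (block s<x x≤) → ¬-not λ Px → none (x , s≤s x≤ , s<x , Px)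

hits-⁅⁆ : ∀ {s t a} → Block s t a → Hits ⁅ a ⁆ s t
hits-⁅⁆ {a = a} ba = a , ba , ⁅⁆-self a

hits-∪ˡ : ∀ {P} Q {s t} → Hits P s t → Hits (P ∪ Q) s t
hits-∪ˡ {P} Q (x , bx , Px) = x , bx , ∪-trueˡ P Q Px

hits-∪ʳ : ∀ P {Q s t} → Hits Q s t → Hits (P ∪ Q) s t
hits-∪ʳ P {Q} (x , bx , Qx) = x , bx , ∪-trueʳ P Q Qx

misses-⁅⁆ : ∀ {s t a} → ¬ Block s t a → Misses ⁅ a ⁆ s t
misses-⁅⁆ a∉ bx = ¬-not λ e → a∉ (subst (Block _ _) (sym (⁅⁆-true e)) bx)

misses-∪ : ∀ {P Q s t} → Misses P s t → Misses Q s t → Misses (P ∪ Q) s t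
misses-∪ mP mQ bx = cong₂ _∨_ (mP bx) (mQ bx)

at-most-one-⁅⁆ : ∀ a {s t} → AtMostOne ⁅ a ⁆ s t
at-most-one-⁅⁆ a _ _ ax ay = trans (sym (⁅⁆-true {a} ax)) (⁅⁆-true {a} ay)

at-most-one-∪ : ∀ {P Q s t} → AtMostOne P s t → Misses Q s t → AtMostOne (P ∪ Q) s t
at-most-one-∪ {P} {Q} amo mQ bx by PQx PQy with ∪-true⁻ P Q PQx | ∪-true⁻ P Q PQy
... | inj₁ Px | inj₁ Py = amo bx by Px Py
... | inj₂ Qx | _       = contradiction (trans (sym Qx) (mQ bx)) λ ()
... | _       | inj₂ Qy = contradiction (trans (sym Qy) (mQ by)) λ ()

at-most-one-∪′ : ∀ {P Q s t} → Misses P s t → AtMostOne Q s t → AtMostOne (P ∪ Q) s t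
at-most-one-∪′ {P} {Q} mP amo bx by PQx PQy with ∪-true⁻ P Q PQx | ∪-true⁻ P Q PQy
... | inj₂ Qx | inj₂ Qy = amo bx by Qx Qy
... | inj₁ Px | _       = contradiction (trans (sym Px) (mP bx)) λ ()
... | _       | inj₁ Py = contradiction (trans (sym Py) (mP by)) λ ()

at-most-one-left : ∀ {P s t} → AtMostOne P s (suc t) → AtMostOne P s t
at-most-one-left amo bx by = amo (block-left bx) (block-left by)

at-most-one-right : ∀ {P s t} → AtMostOne P s (suc t) → AtMostOne P (s + 2 ^ t) t
at-most-one-right amo bx by = amo (block-right bx) (block-right by)

at-most-one⇒misses-half : ∀ {P s t} → AtMostOne P s (suc t) → Misses P s t ⊎ Misses P (s + 2 ^ t) t
at-most-one⇒misses-half {P} {s} {t} amo with hits? P s t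
... | inj₂ misses-left = inj₁ misses-left
... | inj₁ (y , by , Py) = inj₂ λ {x} bx → ¬-not λ Px →
  block-disjoint by (subst (Block _ _) (amo (block-right bx) (block-left by) Px Py) bx)

-- The words B₁ and B₂

B1-falls : ∀ P {s} t {x} → Block s t x → P x ≡ true → Falls P (B1 s t)
B1-falls P {s} zero bx Px with refl ← block-zero bx = falls (≡⇒≈ (delete-removed P true [] Px))
B1-falls P {s} (suc t) bx Px with block-split bx
... | inj₁ bx-left  = falls-commˡ (B1 (s + 2 ^ t) t) (B1-falls P t bx-left Px)
... | inj₂ bx-right = falls-commʳ (B1 s t) (B1-falls P t bx-right Px)

B1-separates : ∀ {P s t s′ t′ r} → Block s t r → Misses (P ∪ ⁅ r ⁆) s′ t′ →
               Separates P (B1 s t) (B1 s′ t′)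
B1-holds : ∀ P {s} t → Misses P s t → Holds P (B1 s t)

B1-separates {P} {t = t} {t′ = t′} {r} br misses =
  ⁅ r ⁆ , B1-falls (P ∪ ⁅ r ⁆) t br (∪-trueʳ P ⁅ r ⁆ (⁅⁆-self r)) , B1-holds (P ∪ ⁅ r ⁆) t′ misses

B1-holds P {s} zero misses (falls P[s+1]≈[]) = letter≉[] (suc s , true)
  (≈-trans (≡⇒≈ (sym (delete-kept P true [] (misses (block-first s 0))))) P[s+1]≈[])
B1-holds P {s} (suc t) misses = proj₂ (comm-holds (B1-holds P t (misses ∘ block-right))
  (B1-separates (block-first (s + 2 ^ t) t)
                (misses-∪ (misses ∘ block-left) (misses-⁅⁆ λ br → block-disjoint br (block-first _ t)))))

cross : ℕ → ℕ → Word
cross s t = B1 s t ++ B1 (s + 2 ^ t) t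

cross-falls : ∀ {P s t} → Hits P s t → Hits P (s + 2 ^ t) t → Falls P (cross s t)
cross-falls {P} {s} {t} (x , bx , Px) (y , by , Py) = falls-++ (B1-falls P t bx Px) (B1-falls P t by Py)

cross-holds : ∀ {P s t} → Misses P s t ⊎ Misses P (s + 2 ^ t) t → Holds P (cross s t)
cross-holds {P} {s} {t} (inj₁ misses-left) = proj₂ (++-holds
  (B1-separates (block-first (s + 2 ^ t) t)
                (misses-∪ misses-left (misses-⁅⁆ λ br → block-disjoint br (block-first _ t)))))
cross-holds {P} {s} {t} (inj₂ misses-right) = proj₁ (++-holds
  (B1-separates (block-first s t) (misses-∪ misses-right (misses-⁅⁆ (block-disjoint (block-first s t))))))

base-is-cross : ∀ s → (suc s , true) ∷ (suc (suc s) , true) ∷ [] ≡ cross s 0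
base-is-cross s = cong (λ n → (suc s , true) ∷ (suc n , true) ∷ []) (+-comm 1 s)

arrange-⊎ : ∀ {A : Word → Set} {a b c X Y Z} → Arrange a b c X Y Z → A a ⊎ A b ⊎ A c → A X ⊎ A Y ⊎ A Z
arrange-⊎ abc = id
arrange-⊎ acb = map₂ swap
arrange-⊎ bac = [ inj₂ ∘ inj₁ , [ inj₁ , inj₂ ∘ inj₂ ]′ ]′
arrange-⊎ bca = [ inj₂ ∘ inj₂ , map₂ inj₁ ]′
arrange-⊎ cab = [ inj₂ ∘ inj₁ , [ inj₂ ∘ inj₂ , inj₁ ]′ ]′
arrange-⊎ cba = [ inj₂ ∘ inj₂ , [ inj₂ ∘ inj₁ , inj₁ ]′ ]′

nested-comm-falls : ∀ {P X Y Z} → Falls P X ⊎ Falls P Y ⊎ Falls P Z → Falls P (comm X (comm Y Z))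
nested-comm-falls {Y = Y} {Z} (inj₁ PX)        = falls-commˡ (comm Y Z) PX
nested-comm-falls {X = X} {Z = Z} (inj₂ (inj₁ PY)) = falls-commʳ X (falls-commˡ Z PY)
nested-comm-falls {X = X} {Y}  (inj₂ (inj₂ PZ)) = falls-commʳ X (falls-commʳ Y PZ)

nested-comm-holds : ∀ {P X Y Z} → Holds P X → Holds P Y → Holds P Z →
                    Separates P Y Z ⊎ Separates P Z Y → Separates P Y X ⊎ Separates P Z X →
                    Holds P (comm X (comm Y Z))
nested-comm-holds {P} {X} {Y} {Z} PX PY PZ inner outer = proj₂ (comm-holds inner-holds outer-separates)
  where
  inner-holds : Holds P (comm Y Z)
  inner-holds = [ proj₁ ∘ comm-holds PY , proj₂ ∘ comm-holds PZ ]′ inner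
  outer-separates : Separates P (comm Y Z) X
  outer-separates = [ (λ (K , PKY , PKX) → K , falls-commˡ Z PKY , PKX)
                    , (λ (K , PKZ , PKX) → K , falls-commʳ Y PKZ , PKX) ]′ outer

pair-split : ∀ {P s t x y} → Block s (suc t) x → Block s (suc t) y → P x ≡ true → P y ≡ true →
             (Block s t x × Block s t y) ⊎ (Block (s + 2 ^ t) t x × Block (s + 2 ^ t) t y) ⊎
             (Hits P s t × Hits P (s + 2 ^ t) t)
pair-split bx by Px Py with block-split bx | block-split by
... | inj₁ lx | inj₁ ly = inj₁ (lx , ly)
... | inj₂ rx | inj₂ ry = inj₂ (inj₁ (rx , ry))
... | inj₁ lx | inj₂ ry = inj₂ (inj₂ ((_ , lx , Px) , (_ , ry , Py)))
... | inj₂ rx | inj₁ ly = inj₂ (inj₂ ((_ , ly , Py) , (_ , rx , Px)))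

B2-falls : ∀ {P s t w x y} → IsB2 s t w → x ≢ y → Block s t x → Block s t y →
           P x ≡ true → P y ≡ true → Falls P w
B2-falls {P} {x = x} {y} (base s) x≢y bx by Px Py with pair-split {P} {t = 0} bx by Px Py
... | inj₁ (lx , ly)          = contradiction (trans (block-zero lx) (sym (block-zero ly))) x≢y
... | inj₂ (inj₁ (rx , ry))   = contradiction (trans (block-zero rx) (sym (block-zero ry))) x≢y
... | inj₂ (inj₂ (hl , hr))   = subst (Falls P) (sym (base-is-cross s)) (cross-falls hl hr)
B2-falls {P} (step s t hl hr (arr , _)) x≢y bx by Px Py = nested-comm-falls (arrange-⊎ arr (
  [ (λ (lx , ly) → inj₁ (B2-falls hl x≢y lx ly Px Py))
  , [ (λ (rx , ry) → inj₂ (inj₁ (B2-falls hr x≢y rx ry Px Py)))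
    , (λ (hl , hr) → inj₂ (inj₂ (cross-falls hl hr))) ]′ ]′ (pair-split bx by Px Py)))

firstTwo : ℕ → Nails
firstTwo s = ⁅ suc s ⁆ ∪ ⁅ suc (suc s) ⁆

B2-falls-firstTwo : ∀ {P s t w} → IsB2 s (suc t) w → Falls (P ∪ firstTwo s) w
B2-falls-firstTwo {P} {s} {t} hw = B2-falls hw (λ ()) (block-first s (suc t)) (block-second s t)
  (∪-trueʳ P (firstTwo s) {suc s} (∪-trueˡ ⁅ suc s ⁆ ⁅ suc (suc s) ⁆ {suc s} (⁅⁆-self (suc s))))
  (∪-trueʳ P (firstTwo s) {suc (suc s)} (∪-trueʳ ⁅ suc s ⁆ ⁅ suc (suc s) ⁆ {suc (suc s)} (⁅⁆-self (suc (suc s)))))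

firstTwo-misses-right : ∀ s t → Misses (firstTwo s) (s + 2 ^ suc t) (suc t)
firstTwo-misses-right s t =
  misses-∪ (misses-⁅⁆ (block-disjoint (block-first s (suc t)))) (misses-⁅⁆ (block-disjoint (block-second s t)))

firstTwo-misses-left : ∀ s t → Misses (firstTwo (s + 2 ^ suc t)) s (suc t)
firstTwo-misses-left s t = misses-∪ (misses-⁅⁆ λ b → block-disjoint b (block-first _ (suc t)))
                                    (misses-⁅⁆ λ b → block-disjoint b (block-second _ t))

-- K is r together with the first nail of the block, unless P already hits the block.
extend-hit : ∀ {P s t r} → AtMostOne P s t → ¬ Block s t r →
             ∃[ K ] Hits (P ∪ K) s t × (P ∪ K) r ≡ true × AtMostOne (P ∪ K) s t
extend-hit {P} {s} {t} {r} amo r∉ with hits? P s t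
... | inj₁ hit = ⁅ r ⁆ , hits-∪ˡ ⁅ r ⁆ hit , ∪-trueʳ P ⁅ r ⁆ (⁅⁆-self r) , at-most-one-∪ amo (misses-⁅⁆ r∉)
... | inj₂ miss = ⁅ suc s ⁆ ∪ ⁅ r ⁆
                , hits-∪ʳ P (hits-∪ˡ ⁅ r ⁆ (hits-⁅⁆ (block-first s t)))
                , ∪-trueʳ P (⁅ suc s ⁆ ∪ ⁅ r ⁆) (∪-trueʳ ⁅ suc s ⁆ ⁅ r ⁆ (⁅⁆-self r))
                , at-most-one-∪′ miss (at-most-one-∪ (at-most-one-⁅⁆ (suc s)) (misses-⁅⁆ r∉))

B2-holds : ∀ {P s t w} → IsB2 s t w → AtMostOne P s t → Holds P w
B2-holds {P} (base s) amo = subst (Holds P) (sym (base-is-cross s)) (cross-holds (at-most-one⇒misses-half amo))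
B2-holds {P} (step s t {dl} {dr} hl hr (arr , _)) amo = main arr
  where
  m = s + 2 ^ suc t
  amoL = at-most-one-left amo
  amoR = at-most-one-right amo
  l₁∉R : ¬ Block m (suc t) (suc s)
  l₁∉R = block-disjoint (block-first s (suc t))
  r₁∉L : ¬ Block s (suc t) (suc m)
  r₁∉L br = block-disjoint br (block-first m (suc t))
  Pdl = B2-holds hl amoL
  Pdr = B2-holds hr amoR
  Pdx = cross-holds (at-most-one⇒misses-half amo)
  sep-l-r : Separates P dl dr
  sep-l-r = firstTwo s , B2-falls-firstTwo {P} hl , B2-holds hr (at-most-one-∪ amoR (firstTwo-misses-right s t))
  sep-r-l : Separates P dr dl
  sep-r-l = firstTwo m , B2-falls-firstTwo {P} hr , B2-holds hl (at-most-one-∪ amoL (firstTwo-misses-left s t))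
  sep-x-l : Separates P (cross s (suc t)) dl
  sep-x-l with K , hitL , PKr₁ , amoK ← extend-hit amoL r₁∉L =
    K , cross-falls hitL (suc m , block-first m (suc t) , PKr₁) , B2-holds hl amoK
  sep-x-r : Separates P (cross s (suc t)) dr
  sep-x-r with K , hitR , PKl₁ , amoK ← extend-hit amoR l₁∉R =
    K , cross-falls (suc s , block-first s (suc t) , PKl₁) hitR , B2-holds hr amoK
  sep-half-x : Separates P dl (cross s (suc t)) ⊎ Separates P dr (cross s (suc t))
  sep-half-x with at-most-one⇒misses-half amo
  ... | inj₂ missR = inj₁ (firstTwo s , B2-falls-firstTwo {P} hl ,
                           cross-holds (inj₂ (misses-∪ missR (firstTwo-misses-right s t))))
  ... | inj₁ missL = inj₂ (firstTwo m , B2-falls-firstTwo {P} hr ,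
                           cross-holds (inj₁ (misses-∪ missL (firstTwo-misses-left s t))))
  main : ∀ {X Y Z} → Arrange dl dr (cross s (suc t)) X Y Z → Holds P (comm X (comm Y Z))
  main abc = nested-comm-holds Pdl Pdr Pdx (inj₂ sep-x-r) (inj₁ sep-r-l)
  main acb = nested-comm-holds Pdl Pdx Pdr (inj₁ sep-x-r) (inj₂ sep-r-l)
  main bac = nested-comm-holds Pdr Pdl Pdx (inj₂ sep-x-l) (inj₁ sep-l-r)
  main bca = nested-comm-holds Pdr Pdx Pdl (inj₁ sep-x-l) (inj₂ sep-l-r)
  main cab = nested-comm-holds Pdx Pdl Pdr (inj₁ sep-l-r) sep-half-x
  main cba = nested-comm-holds Pdx Pdr Pdl (inj₁ sep-r-l) (swap sep-half-x)

-- Lengths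

length-push : ∀ x w → length (push x w) ≤ suc (length w)
length-push x []       = ≤-refl
length-push x (y ∷ ys) with cancels x y
... | true  = m≤n⇒m≤1+n (n≤1+n (length ys))
... | false = ≤-refl

length-reduce : ∀ w → length (reduce w) ≤ length w
length-reduce []      = z≤n
length-reduce (x ∷ w) = ≤-trans (length-push x (reduce w)) (s≤s (length-reduce w))

length-comm : ∀ u v → length (comm u v) ≡ 2 * length u + 2 * length v
length-comm u v = begin
  length (u ++ v ++ inv u ++ inv v)                            ≡⟨ length-++ u ⟩
  length u + length (v ++ inv u ++ inv v)                      ≡⟨ cong (length u +_) (length-++ v) ⟩
  length u + (length v + length (inv u ++ inv v))              ≡⟨ cong (λ n → length u + (length v + n)) (length-++ (inv u)) ⟩
  length u + (length v + (length (inv u) + length (inv v)))    ≡⟨ cong₂ (λ m n → length u + (length v + (m + n))) (length-inv u) (length-inv v) ⟩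
  length u + (length v + (length u + length v))                ≡⟨ arith (length u) (length v) ⟩
  2 * length u + 2 * length v                                  ∎
  where
  open ≡-Reasoning
  arith : ∀ p q → p + (q + (p + q)) ≡ 2 * p + 2 * q
  arith = solve-∀

length-B1 : ∀ s t → length (B1 s t) ≡ 4 ^ t
length-B1 s zero    = refl
length-B1 s (suc t) = begin
  length (comm (B1 s t) (B1 (s + 2 ^ t) t))                    ≡⟨ length-comm (B1 s t) (B1 (s + 2 ^ t) t) ⟩
  2 * length (B1 s t) + 2 * length (B1 (s + 2 ^ t) t)          ≡⟨ cong₂ (λ m n → 2 * m + 2 * n) (length-B1 s t) (length-B1 _ t) ⟩
  2 * 4 ^ t + 2 * 4 ^ t                                        ≡⟨ arith (4 ^ t) ⟩
  4 * 4 ^ t                                                    ∎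
  where
  open ≡-Reasoning
  arith : ∀ p → 2 * p + 2 * p ≡ 4 * p
  arith = solve-∀

length-cross : ∀ s t → length (cross s t) ≡ 2 * 4 ^ t
length-cross s t = trans (length-++ (B1 s t)) (trans (cong₂ _+_ (length-B1 s t) (length-B1 _ t)) (arith (4 ^ t)))
  where
  arith : ∀ p → p + p ≡ 2 * p
  arith = solve-∀

Choice-max : ∀ {a b c X Y Z} → Choice a b c X Y Z → length X ≡ length a ⊔ length b ⊔ length c
Choice-max (abc , Y≤X , Z≤X) = sym (trans (cong (_⊔ _) (m≥n⇒m⊔n≡m Y≤X)) (m≥n⇒m⊔n≡m Z≤X))
Choice-max (acb , Y≤X , Z≤X) = sym (trans (cong (_⊔ _) (m≥n⇒m⊔n≡m Z≤X)) (m≥n⇒m⊔n≡m Y≤X))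
Choice-max (bac , Y≤X , Z≤X) = sym (trans (cong (_⊔ _) (m≤n⇒m⊔n≡n Y≤X)) (m≥n⇒m⊔n≡m Z≤X))
Choice-max (bca , Y≤X , Z≤X) = sym (trans (cong (_⊔ _) (m≤n⇒m⊔n≡n Z≤X)) (m≥n⇒m⊔n≡m Y≤X))
Choice-max (cab , Y≤X , Z≤X) = sym (m≤n⇒m⊔n≡n (⊔-lub Y≤X Z≤X))
Choice-max (cba , Y≤X , Z≤X) = sym (m≤n⇒m⊔n≡n (⊔-lub Z≤X Y≤X))

Arrange-length : ∀ {a b c X Y Z} → Arrange a b c X Y Z →
                 length X + length Y + length Z ≡ length a + length b + length c
Arrange-length {a} {b} {c} abc = refl
Arrange-length {a} {b} {c} acb = arith (length a) (length c) (length b)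
  where arith : ∀ x y z → x + y + z ≡ x + z + y
        arith = solve-∀
Arrange-length {a} {b} {c} bac = arith (length b) (length a) (length c)
  where arith : ∀ x y z → x + y + z ≡ y + x + z
        arith = solve-∀
Arrange-length {a} {b} {c} bca = arith (length b) (length c) (length a)
  where arith : ∀ x y z → x + y + z ≡ z + x + y
        arith = solve-∀
Arrange-length {a} {b} {c} cab = arith (length c) (length a) (length b)
  where arith : ∀ x y z → x + y + z ≡ y + z + x
        arith = solve-∀
Arrange-length {a} {b} {c} cba = arith (length c) (length b) (length a)
  where arith : ∀ x y z → x + y + z ≡ z + y + x
        arith = solve-∀

-- The maximal word is counted twice in [X, [Y, Z]], the others four times.
Choice-length : ∀ {a b c X Y Z} → Choice a b c X Y Z →
                length (comm X (comm Y Z)) + 2 * (length a ⊔ length b ⊔ length c) ≡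
                4 * (length a + length b + length c)
Choice-length {a} {b} {c} {X} {Y} {Z} ch@(arr , _) = begin
  length (comm X (comm Y Z)) + 2 * (length a ⊔ length b ⊔ length c)
    ≡⟨ cong₂ (λ m n → m + 2 * n) (length-comm X (comm Y Z)) (sym (Choice-max ch)) ⟩
  2 * length X + 2 * length (comm Y Z) + 2 * length X
    ≡⟨ cong (λ n → 2 * length X + 2 * n + 2 * length X) (length-comm Y Z) ⟩
  2 * length X + 2 * (2 * length Y + 2 * length Z) + 2 * length X
    ≡⟨ arith (length X) (length Y) (length Z) ⟩
  4 * (length X + length Y + length Z)
    ≡⟨ cong (4 *_) (Arrange-length arr) ⟩
  4 * (length a + length b + length c) ∎
  where
  open ≡-Reasoning
  arith : ∀ x y z → 2 * x + 2 * (2 * y + 2 * z) + 2 * x ≡ 4 * (x + y + z)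
  arith = solve-∀

9*4^[2+k]≤4*6^[2+k] : ∀ k → 9 * 4 ^ (2 + k) ≤ 4 * 6 ^ (2 + k)
9*4^[2+k]≤4*6^[2+k] zero    = ≤-refl
9*4^[2+k]≤4*6^[2+k] (suc k) = begin
  9 * (4 * 4 ^ (2 + k))   ≡⟨ arith (4 ^ (2 + k)) ⟩
  4 * (9 * 4 ^ (2 + k))   ≤⟨ *-monoʳ-≤ 4 (9*4^[2+k]≤4*6^[2+k] k) ⟩
  4 * (4 * 6 ^ (2 + k))   ≤⟨ *-monoˡ-≤ (4 * 6 ^ (2 + k)) {4} {6} (s≤s (s≤s (s≤s (s≤s z≤n)))) ⟩
  6 * (4 * 6 ^ (2 + k))   ≡⟨ arith′ (6 ^ (2 + k)) ⟩
  4 * (6 * 6 ^ (2 + k))   ∎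
  where
  open ≤-Reasoning
  arith : ∀ p → 9 * (4 * p) ≡ 4 * (9 * p)
  arith = solve-∀
  arith′ : ∀ p → 6 * (4 * p) ≡ 4 * (6 * p)
  arith′ = solve-∀

-- Hence, once the halves have at least four nails, the longest entry of B₂ is B₂ of a half.
cross-≤-B2 : ∀ k ℓ → 3 * ℓ + 12 * 4 ^ (2 + k) ≡ 8 * 6 ^ (2 + k) → 2 * 4 ^ (2 + k) ≤ ℓ
cross-≤-B2 k ℓ closed = *-cancelˡ-≤ 3 (+-cancelʳ-≤ (12 * A) (3 * (2 * A)) (3 * ℓ) (begin
  3 * (2 * A) + 12 * A    ≡⟨ arith A ⟩
  2 * (9 * A)             ≤⟨ *-monoʳ-≤ 2 (9*4^[2+k]≤4*6^[2+k] k) ⟩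
  2 * (4 * 6 ^ (2 + k))   ≡⟨ arith′ (6 ^ (2 + k)) ⟩
  8 * 6 ^ (2 + k)         ≡⟨ closed ⟨
  3 * ℓ + 12 * A          ∎))
  where
  A = 4 ^ (2 + k)
  open ≤-Reasoning
  arith : ∀ p → 3 * (2 * p) + 12 * p ≡ 2 * (9 * p)
  arith = solve-∀
  arith′ : ∀ p → 2 * (4 * p) ≡ 8 * p
  arith′ = solve-∀

B2-length-step : ∀ {n ℓ A B} → 3 * ℓ + 12 * A ≡ 8 * B → n + 2 * ℓ ≡ 4 * (ℓ + ℓ + 2 * A) →
                 3 * n + 12 * (4 * A) ≡ 8 * (6 * B)
B2-length-step {n} {ℓ} {A} {B} closed n+2ℓ≡ = +-cancelʳ-≡ (6 * ℓ) _ _ (begin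
  3 * n + 12 * (4 * A) + 6 * ℓ        ≡⟨ arith n ℓ A ⟩
  3 * (n + 2 * ℓ) + 48 * A            ≡⟨ cong (λ m → 3 * m + 48 * A) n+2ℓ≡ ⟩
  3 * (4 * (ℓ + ℓ + 2 * A)) + 48 * A  ≡⟨ arith′ ℓ A ⟩
  6 * (3 * ℓ + 12 * A) + 6 * ℓ        ≡⟨ cong (λ m → 6 * m + 6 * ℓ) closed ⟩
  6 * (8 * B) + 6 * ℓ                 ≡⟨ arith″ B ℓ ⟩
  8 * (6 * B) + 6 * ℓ                 ∎)
  where
  open ≡-Reasoning
  arith : ∀ n ℓ A → 3 * n + 12 * (4 * A) + 6 * ℓ ≡ 3 * (n + 2 * ℓ) + 48 * A
  arith = solve-∀
  arith′ : ∀ ℓ A → 3 * (4 * (ℓ + ℓ + 2 * A)) + 48 * A ≡ 6 * (3 * ℓ + 12 * A) + 6 * ℓ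
  arith′ = solve-∀
  arith″ : ∀ B ℓ → 6 * (8 * B) + 6 * ℓ ≡ 8 * (6 * B) + 6 * ℓ
  arith″ = solve-∀

B2-length : ∀ {s t w} → IsB2 s (2 + t) w → 3 * length w + 12 * 4 ^ (2 + t) ≡ 8 * 6 ^ (2 + t)
B2-length {w = w} (step s zero (base _) (base _) ch) =
  cong (λ n → 3 * n + 192) (+-cancelʳ-≡ 16 (length w) 32 (Choice-length ch))
B2-length {w = w} (step s (suc t) {dl} {dr} hl hr ch) =
  B2-length-step {length w} {ℓ} {4 ^ (2 + t)} {6 ^ (2 + t)} (B2-length hl) (begin
  length w + 2 * ℓ                                  ≡⟨ cong (λ m → length w + 2 * m) max≡ℓ ⟨
  length w + 2 * (ℓ ⊔ length dr ⊔ length dx)        ≡⟨ Choice-length ch ⟩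
  4 * (ℓ + length dr + length dx)                   ≡⟨ cong₂ (λ m n → 4 * (ℓ + m + n)) |dr|≡ℓ (length-cross s (2 + t)) ⟩
  4 * (ℓ + ℓ + 2 * 4 ^ (2 + t))                     ∎)
  where
  open ≡-Reasoning
  ℓ = length dl
  dx = cross s (2 + t)
  |dr|≡ℓ : length dr ≡ ℓ
  |dr|≡ℓ = *-cancelˡ-≡ (length dr) ℓ 3 (+-cancelʳ-≡ _ _ _ (trans (B2-length hr) (sym (B2-length hl))))
  max≡ℓ : ℓ ⊔ length dr ⊔ length dx ≡ ℓ
  max≡ℓ = trans (cong₂ (λ m n → ℓ ⊔ m ⊔ n) |dr|≡ℓ (length-cross s (2 + t)))
                (trans (cong (_⊔ _) (⊔-idem ℓ)) (m≥n⇒m⊔n≡m (cross-≤-B2 t ℓ (B2-length hl))))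

-- The puzzle

one-member : ∀ {n k} (p : Subset n) → ∣ p ∣ ≡ suc k → ∃[ i ] i ∈ p
one-member (true  ∷ p) _ = zero , here
one-member (false ∷ p) e with i , i∈p ← one-member p e = suc i , there i∈p

two-members : ∀ {n} (p : Subset n) → ∣ p ∣ ≡ 2 → ∃[ i ] ∃[ j ] i ≢ j × i ∈ p × j ∈ p
two-members (true  ∷ p) e with j , j∈p ← one-member p (suc-injective e) = zero , suc j , (λ ()) , here , there j∈p
two-members (false ∷ p) e with i , j , i≢j , i∈p , j∈p ← two-members p e =
  suc i , suc j , i≢j ∘ Fin.suc-injective , there i∈p , there j∈p

at-most-one-member : ∀ {n} {p : Subset n} {i j} → ∣ p ∣ < 2 → i ∈ p → j ∈ p → i ≡ j
at-most-one-member {p = p} {i} {j} |p|<2 i∈p j∈p with i Fin.≟ j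
... | yes i≡j = i≡j
... | no  i≢j = contradiction (≤-trans (s≤s (≤-trans (s≤s z≤n) ∣p-i-j∣<∣p-i∣)) ∣p-i∣<∣p∣) (<⇒≱ |p|<2)
  where
  ∣p-i∣<∣p∣ = x∈p⇒∣p-x∣<∣p∣ i∈p
  ∣p-i-j∣<∣p-i∣ = x∈p⇒∣p-x∣<∣p∣ (x∈p∧x≢y⇒x∈p-y j∈p (i≢j ∘ sym))

inS-member : ∀ {n} (S : Subset n) {j} → j ∈ S → inS S (suc (toℕ j)) ≡ true
inS-member {n} S {j} j∈S with toℕ j <? n
... | yes j<n = trans (cong (lookup S) (fromℕ<-toℕ j j<n)) ([]=⇒lookup j∈S)
... | no  j≮n = contradiction (toℕ<n j) j≮n

inS-true : ∀ {n} (S : Subset n) {x} → inS S x ≡ true → ∃[ j ] x ≡ suc (toℕ j) × j ∈ S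
inS-true {n} S {suc m} e with m <? n
... | yes m<n = fromℕ< m<n , cong suc (sym (toℕ-fromℕ< m<n)) , lookup⇒[]= _ S e

inS-block : ∀ {i} (S : Subset (2 ^ i)) {x} → inS S x ≡ true → Block 0 i x
inS-block S {x} e with j , refl , _ ← inS-true S {x} e = block (s≤s z≤n) (toℕ<n j)

inS-at-most-one : ∀ {i} (S : Subset (2 ^ i)) → ∣ S ∣ < 2 → AtMostOne (inS S) 0 i
inS-at-most-one S |S|<2 {x} {y} _ _ Sx Sy with inS-true S {x} Sx | inS-true S {y} Sy
... | j , refl , j∈S | k , refl , k∈S = cong (suc ∘ toℕ) (at-most-one-member |S|<2 j∈S k∈S)

inS-two-nails : ∀ {i} (S : Subset (2 ^ i)) → ∣ S ∣ ≡ 2 →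
                ∃[ x ] ∃[ y ] x ≢ y × Block 0 i x × Block 0 i y × inS S x ≡ true × inS S y ≡ true
inS-two-nails S |S|≡2 with j , k , j≢k , j∈S , k∈S ← two-members S |S|≡2 =
  suc (toℕ j) , suc (toℕ k) , j≢k ∘ toℕ-injective ∘ suc-injective ,
  inS-block S (inS-member S j∈S) , inS-block S (inS-member S k∈S) , inS-member S j∈S , inS-member S k∈S

falls⇒IsZero : ∀ {n} (S : Subset n) {w} → Falls (inS S) w → IsZero (restrict S w)
falls⇒IsZero S (falls (mk≈ e)) = e

theorem3p7 : ∀ (i : ℕ) → 2 ≤ i → ∀ (w : Word) → IsB2 0 i w →
    Solution 2 (2 ^ i) w × (3 * len w + 12 * 4 ^ i ≤ 8 * 6 ^ i)
theorem3p7 i@(suc (suc t)) (s≤s (s≤s z≤n)) w hw = solution , length-bound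
  where
  solution : Solution 2 (2 ^ i) w
  solution = record
    { nonzero = λ w≡0 → B2-holds {λ _ → false} hw (λ _ _ ())
                          (falls (mk≈ (trans (cong reduce (delete-nothing w)) w≡0)))
    ; falls   = λ S |S|≡2 → let x , y , x≢y , bx , by , Sx , Sy = inS-two-nails S |S|≡2 in
                  falls⇒IsZero S (B2-falls hw x≢y bx by Sx Sy)
    ; holds   = λ S |S|<2 w≡0 → B2-holds hw (inS-at-most-one S |S|<2) (falls (mk≈ w≡0))
    }
  length-bound : 3 * len w + 12 * 4 ^ i ≤ 8 * 6 ^ i
  length-bound = ≤-trans (+-monoˡ-≤ (12 * 4 ^ i) (*-monoʳ-≤ 3 (length-reduce w))) (≤-reflexive (B2-length hw))
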